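{- Condition on the event $\mathbf{Y}\in\mathcal{E}$ and let $\mathbf{Y}'$ be obtained from $\mathbf{Y}$ by the red-loop swapping procedure described in the context. Then for each $l=0,\dots,L$, conditionally on $\mathbf{Y}'\in\mathcal{G}_l$, the sequence $\mathbf{Y}'$ is uniformly distributed on $\mathcal{G}_l$.
   Context: Fix $k\ge3$ and positive integers $n,d$ with $k\mid nd$; let $M=nd/k$, $r=2^k+1$, $c=1/(2r+1)$, $m=\lfloor cM\rfloor$, $L=n^{1/4}d^{1/2}$. $\mathcal{S}\subset[n]^{nd}$ is the set of sequences in which every $i\in[n]$ occurs exactly $d$ times; $\mathbf{Y}$ is uniform on $\mathcal{S}$. The edges of $\mathbf{y}\in\mathcal{S}$ are the consecutive blocks $(y_{ki+1},\dots,y_{ki+k})$, $i=0,\dots,M-1$, regarded as multisets; an edge is a loop if it has a repeated vertex and proper otherwise; $\mathbf{y}$ has multiple edges if two edges coincide as multisets; $\lambda(\mathbf{y})$ is the number of loops. The first $rm$ edges (positions $1,\dots,krm$) are red, the remaining $M-rm$ edges are green. $\mathcal{E}$ is the set of $\mathbf{y}\in\mathcal{S}$ with no multiple edges, at most $L$ loops, and every loop of the form $\{x_1,x_1,x_2,\dots,x_{k-1}\}$ (as a multiset) with $x_1,\dots,x_{k-1}$ distinct. $\mathcal{E}_l=\{\mathbf{y}\in\mathcal{E}:\lambda(\mathbf{y})=l\}$ and $\mathcal{G}_l$ is the set of sequences in $\mathcal{E}_l$ with no red loops. Given $\mathbf{Y}\in\mathcal{E}$, let $f_1,\dots,f_q$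 be its red loops and $e_1,\dots,e_g$ its green proper edges in order of appearance; choose indices $1\le i_1<\dots<i_q\le g$ uniformly at random among all such $q$-sets, and for $j=1,\dots,q$ swap the block $f_j$ with the block $e_{i_j}$ (preserving the order of entries within each block). The result is $\mathbf{Y}'$. -}

module Defs where

open import Data.Nat using (ℕ; zero; suc; _+_; _*_; _∸_; _^_; _≡ᵇ_; _≤ᵇ_)
open import Data.Fin using (Fin)
import Data.Fin as Fin
open import Data.Bool using (Bool; true; false; _∧_; not; if_then_else_)
open import Data.List using (List; []; _∷_; _++_; map; length; take; drop;
  upTo; allFin; concatMap; zip; foldl; foldr)
open import Data.Bool.ListAction using (all; any)
open import Data.Product using (_×_; _,_)
open import Data.Integer using (+_)
open import Data.Rational using (ℚ; 0ℚ; _/_)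
import Data.Rational as ℚ
open import Relation.Nullary using (does)

count : ∀ {n} → Fin n → List (Fin n) → ℕ
count v []       = 0
count v (x ∷ xs) = if does (v Fin.≟ x) then suc (count v xs) else count v xs

eqSeq : ∀ {n} → List (Fin n) → List (Fin n) → Bool
eqSeq []       []       = true
eqSeq []       (_ ∷ _)  = false
eqSeq (_ ∷ _)  []       = false
eqSeq (x ∷ xs) (y ∷ ys) = does (x Fin.≟ y) ∧ eqSeq xs ys

allSeqs : (n len : ℕ) → List (List (Fin n))
allSeqs n zero      = [] ∷ []
allSeqs n (suc len) = concatMap (λ x → map (x ∷_) (allSeqs n len)) (allFin n)

-- all q-element subsets of a list, each listed in increasing (list) order
choose : ∀ {A : Set} → ℕ → List A → List (List A)
choose zero    xs       = [] ∷ []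
choose (suc q) []       = []
choose (suc q) (x ∷ xs) = map (x ∷_) (choose q xs) ++ choose (suc q) xs

filterᵇ : ∀ {A : Set} → (A → Bool) → List A → List A
filterᵇ p []       = []
filterᵇ p (x ∷ xs) = if p x then x ∷ filterᵇ p xs else filterᵇ p xs

sumℚ : List ℚ → ℚ
sumℚ = foldr ℚ._+_ 0ℚ

-- a / c as a rational, with the convention a / 0 = 0
frac : ℕ → ℕ → ℚ
frac a zero    = 0ℚ
frac a (suc c) = (+ a) / suc c

inS : (n d : ℕ) → List (Fin n) → Bool
inS n d y = (length y ≡ᵇ n * d) ∧ all (λ v → count v y ≡ᵇ d) (allFin n)

-- the i-th edge (i = 0,…,M-1): positions k·i+1,…,k·i+k
edge : ∀ {n} → (k : ℕ) → List (Fin n) → ℕ → List (Fin n)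
edge k y i = take k (drop (k * i) y)

edges : ∀ {n} → (k M : ℕ) → List (Fin n) → List (List (Fin n))
edges k M y = map (edge k y) (upTo M)

sameMultiset : (n : ℕ) → List (Fin n) → List (Fin n) → Bool
sameMultiset n e e' = all (λ v → count v e ≡ᵇ count v e') (allFin n)

isLoop : (n : ℕ) → List (Fin n) → Bool
isLoop n e = any (λ v → 2 ≤ᵇ count v e) (allFin n)

-- loop of the form {x₁,x₁,x₂,…,x_{k-1}} with x₁,…,x_{k-1} distinct:
-- exactly one vertex occurs twice, every other vertex at most once
goodLoop : (n : ℕ) → List (Fin n) → Bool
goodLoop n e = all (λ v → count v e ≤ᵇ 2) (allFin n)
             ∧ (length (filterᵇ (λ v → count v e ≡ᵇ 2) (allFin n)) ≡ᵇ 1)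

noMultiple : (n : ℕ) → List (List (Fin n)) → Bool
noMultiple n []       = true
noMultiple n (e ∷ es) = all (λ e' → not (sameMultiset n e e')) es ∧ noMultiple n es

numLoops : (n k M : ℕ) → List (Fin n) → ℕ
numLoops n k M y = length (filterᵇ (isLoop n) (edges k M y))

r : ℕ → ℕ
r k = 2 ^ k + 1

mm : (k M : ℕ) → ℕ
mm k M = Data.Nat._/_ M (suc (2 * r k))

numRed : (k M : ℕ) → ℕ
numRed k M = r k * mm k M

-- x ≤ L = n^{1/4} d^{1/2}  (for natural x)  iff  x⁴ ≤ n·d²
≤L : (n d x : ℕ) → Bool
≤L n d x = x ^ 4 ≤ᵇ n * d ^ 2

inE : (n d k M : ℕ) → List (Fin n) → Bool
inE n d k M y = inS n d y
              ∧ noMultiple n (edges k M y)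
              ∧ ≤L n d (numLoops n k M y)
              ∧ all (λ e → if isLoop n e then goodLoop n e else true) (edges k M y)

inG : (n d k M l : ℕ) → List (Fin n) → Bool
inG n d k M l y = inE n d k M y
                ∧ (numLoops n k M y ≡ᵇ l)
                ∧ all (λ e → not (isLoop n e)) (take (numRed k M) (edges k M y))

setBlock : ∀ {n} → (k i : ℕ) → List (Fin n) → List (Fin n) → List (Fin n)
setBlock k i b y = take (k * i) y ++ b ++ drop (k * i + k) y

swapBlocks : ∀ {n} → (k : ℕ) → List (Fin n) → ℕ × ℕ → List (Fin n)
swapBlocks k y (i , j) = setBlock k j (edge k y i) (setBlock k i (edge k y j) y)

redLoopIdx : (n k M : ℕ) → List (Fin n) → List ℕ
redLoopIdx n k M y = filterᵇ (λ i → isLoop n (edge k y i)) (upTo (numRed k M))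

greenProperIdx : (n k M : ℕ) → List (Fin n) → List ℕ
greenProperIdx n k M y =
  filterᵇ (λ i → not (isLoop n (edge k y i)))
         (map (λ j → numRed k M + j) (upTo (M ∸ numRed k M)))

-- the list of outcomes Y', one for each choice of i₁<…<i_q
-- (all choices are equally likely; the list has C(g,q) entries)
outcomes : (n k M : ℕ) → List (Fin n) → List (List (Fin n))
outcomes n k M y =
  map (λ c → foldl (swapBlocks k) y (zip (redLoopIdx n k M y) c))
      (choose (length (redLoopIdx n k M y)) (greenProperIdx n k M y))

listE : (n d k M : ℕ) → List (List (Fin n))
listE n d k M = filterᵇ (inE n d k M) (allSeqs n (n * d))

listG : (n d k M l : ℕ) → List (List (Fin n))
listG n d k M l = filterᵇ (inG n d k M l) (allSeqs n (n * d))

-- P(Y' ∈ A | Y ∈ ℰ) for a decidable event A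
--   = (1/|ℰ|) Σ_{y ∈ ℰ} #{choices giving Y' ∈ A} / C(g,q)
probY' : (n d k M : ℕ) → (List (Fin n) → Bool) → ℚ
probY' n d k M A =
  sumℚ (map (λ y → frac (length (filterᵇ A (outcomes n k M y)))
                        (length (outcomes n k M y)))
            (listE n d k M))
  ℚ.* frac 1 (length (listE n d k M))

module Submission where

-- All probabilities are finite averages, so the claim is the identity
--   P(Y' = z) · |𝒢_l| = P(Y' ∈ 𝒢_l)   for every z ∈ 𝒢_l.
-- Since P(Y' ∈ 𝒢_l) = Σ_{z ∈ 𝒢_l} P(Y' = z), it suffices to show that the
-- unnormalised weight  W(z) = Σ_{y ∈ ℰ} #{choices turning y into z} / #{choices}
-- depends on l only.  We sort the pairs (y, choice) by the set S of red loop
-- positions of y and the set T of green positions chosen (|T| = |S|).  For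
-- fixed S and T the block exchange σ_{S,T} is an involution, so the only
-- candidate is y = σ_{S,T} z.  This y has the edges of z in another order,
-- hence lies in ℰ; its red loops sit exactly at S iff z has loops at all of T;
-- and it has |S| + g(z) green proper edges, where g(z) = G − l.  Therefore
--   W(z) = Σ_S  C(l, |S|) / C(|S| + G − l, |S|),
-- a function of l alone.

open import Defs
open import Data.Nat using (ℕ; _*_; _≤_)
open import Data.Bool using (true)
open import Data.List using (length)
open import Data.Rational using (0ℚ) renaming (_<_ to _<ℚ_; _*_ to _*ℚ_)
open import Relation.Binary.PropositionalEquality using (_≡_)

open import Data.Nat using (zero; suc; _+_; _∸_; _<_; _≡ᵇ_; z≤n; s≤s)
import Data.Nat as ℕ
import Data.Nat.Properties as NP
open import Data.Nat.ListAction using (sum)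
open import Data.Nat.ListAction.Properties using (sum-↭)
open import Data.Nat.Combinatorics using (_C_; nCk+nC[k+1]≡[n+1]C[k+1])
import Data.Nat.DivMod as DM
open import Data.Bool using (Bool; T; false; _∧_; _∨_; not; if_then_else_)
open import Data.Fin using (Fin)
import Data.Fin as Fin
open import Data.List using (List; []; _∷_; _++_; map; take; drop; upTo; applyUpTo; allFin; tabulate; concatMap; zip; foldl)
import Data.List.Properties as LP
open import Data.Bool.ListAction using (all)
open import Data.Product using (_×_; _,_; proj₁; proj₂; ∃)
open import Data.Sum using (inj₁; inj₂)
open import Data.Integer using (ℤ; +_)
import Data.Integer as ℤ
import Data.Integer.Properties as ZP
open import Data.Integer.Tactic.RingSolver using (solve-∀)
open import Data.Rational using (ℚ; 1ℚ) renaming (_+_ to _+ℚ_)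
import Data.Rational.Properties as QP
import Data.Rational.Unnormalised as U
import Data.Rational.Unnormalised.Properties as UP
open import Data.List.Membership.Propositional using (_∈_; _∉_)
import Data.List.Membership.Propositional.Properties as MP
open import Data.List.Relation.Unary.Any using (here; there)
open import Data.List.Relation.Unary.All as All using (All; []; _∷_)
import Data.List.Relation.Unary.All.Properties as AllP
open import Data.List.Relation.Unary.AllPairs as AP using ()
open import Data.List.Relation.Unary.Unique.Propositional using (Unique)
import Data.List.Relation.Unary.Unique.Propositional.Properties as UqP
open import Data.List.Relation.Binary.Permutation.Propositional as Perm
  using (_↭_; prep; swap; ↭-trans; ↭-refl)
import Data.List.Relation.Binary.Permutation.Propositional.Properties as PermP
open import Data.List.Relation.Binary.Sublist.Propositional
  using (_⊆_; _∷ʳ_; lookup) renaming ([] to ⊆[]; _∷_ to _∷⊆_)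
open import Data.List.Relation.Binary.Sublist.Propositional.Properties using (All-resp-⊆)
open import Data.List.Membership.DecPropositional NP._≟_ using (_∈?_)
open import Relation.Binary.PropositionalEquality using (refl; sym; trans; cong; cong₂; subst; module ≡-Reasoning)
open import Relation.Binary.Definitions using (DecidableEquality)
open import Relation.Nullary using (does; ¬_; yes; no)
open import Relation.Nullary.Decidable using (dec-true; dec-false)
open import Data.Empty using (⊥; ⊥-elim)
open import Function using (_∘_; id)
open ≡-Reasoning

false≢true : false ≡ true → ⊥
false≢true ()

∧-true : ∀ {a b} → a ∧ b ≡ true → a ≡ true × b ≡ true
∧-true {true} {true} _ = refl , refl

not-true : ∀ {b} → not b ≡ true → b ≡ false
not-true {false} _ = refl

bool-ext : (a b : Bool) → (a ≡ true → b ≡ true) → (b ≡ true → a ≡ true) → a ≡ b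
bool-ext false false _ _ = refl
bool-ext false true  _ g = g refl
bool-ext true  false f _ = sym (f refl)
bool-ext true  true  _ _ = refl

∧-swap : ∀ a b c → a ∧ (b ∧ c) ≡ b ∧ (a ∧ c)
∧-swap true  b c = refl
∧-swap false true  c = refl
∧-swap false false c = refl

∧-interchange : ∀ a b c d → (a ∧ b) ∧ (c ∧ d) ≡ (a ∧ c) ∧ (b ∧ d)
∧-interchange true  b c d = ∧-swap b c d
∧-interchange false b c d = refl

does-sym : ∀ {A : Set} (_≟_ : DecidableEquality A) (x y : A) → does (x ≟ y) ≡ does (y ≟ x)
does-sym _≟_ x y with x ≟ y
... | yes x≡y = sym (dec-true (y ≟ x) (sym x≡y))
... | no  x≢y = sym (dec-false (y ≟ x) (λ y≡x → x≢y (sym y≡x)))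

-- `a ≡ᵇ b` is definitionally `does (a ≟ b)`, which gives its specification.
≡ᵇ-refl : ∀ a → (a ≡ᵇ a) ≡ true
≡ᵇ-refl a = dec-true (a NP.≟ a) refl

≡ᵇ-false : ∀ a b → ¬ a ≡ b → (a ≡ᵇ b) ≡ false
≡ᵇ-false a b = dec-false (a NP.≟ b)

≡ᵇ-sound : ∀ a b → (a ≡ᵇ b) ≡ true → a ≡ b
≡ᵇ-sound a b e = NP.≡ᵇ⇒≡ a b (subst T (sym e) _)

module _ {A : Set} where

  all-true : (p : A → Bool) (xs : List A) → all p xs ≡ true → ∀ {x} → x ∈ xs → p x ≡ true
  all-true p (y ∷ xs) e (here refl) = proj₁ (∧-true e)
  all-true p (y ∷ xs) e (there m)   = all-true p xs (proj₂ (∧-true {p y} e)) m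

  all-intro : (p : A → Bool) (xs : List A) → (∀ x → x ∈ xs → p x ≡ true) → all p xs ≡ true
  all-intro p []       h = refl
  all-intro p (x ∷ xs) h rewrite h x (here refl) = all-intro p xs (λ y m → h y (there m))

  all-false : (p : A → Bool) (xs : List A) → all p xs ≡ false → ∃ λ x → x ∈ xs × p x ≡ false
  all-false p (x ∷ xs) e with p x in px
  ... | true  = let (y , m , q) = all-false p xs e in y , there m , q
  ... | false = x , here refl , px

  all-cong : {p q : A → Bool} (xs : List A) → (∀ x → p x ≡ q x) → all p xs ≡ all q xs
  all-cong []       h = refl
  all-cong (x ∷ xs) h = cong₂ _∧_ (h x) (all-cong xs h)

  all-↭ : (p : A → Bool) {xs ys : List A} → xs ↭ ys → all p xs ≡ all p ys
  all-↭ p Perm.refl          = refl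
  all-↭ p (prep x q)         = cong (p x ∧_) (all-↭ p q)
  all-↭ p (swap x y q)       = trans (cong (λ t → p x ∧ (p y ∧ t)) (all-↭ p q)) (∧-swap (p x) (p y) _)
  all-↭ p (Perm.trans q q′)  = trans (all-↭ p q) (all-↭ p q′)

  filter-sound : (p : A → Bool) (xs : List A) → ∀ {y} → y ∈ filterᵇ p xs → p y ≡ true
  filter-sound p (x ∷ xs) m with p x in px
  filter-sound p (x ∷ xs) (here refl) | true = px
  filter-sound p (x ∷ xs) (there m)   | true = filter-sound p xs m
  ... | false = filter-sound p xs m

  filter-⊆ : (p : A → Bool) (xs : List A) → ∀ {y} → y ∈ filterᵇ p xs → y ∈ xs
  filter-⊆ p (x ∷ xs) m with p x
  filter-⊆ p (x ∷ xs) (here e)  | true = here e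
  filter-⊆ p (x ∷ xs) (there m) | true = there (filter-⊆ p xs m)
  ... | false = there (filter-⊆ p xs m)

  filter-cong : {p q : A → Bool} (xs : List A) → (∀ x → x ∈ xs → p x ≡ q x) → filterᵇ p xs ≡ filterᵇ q xs
  filter-cong []                 h = refl
  filter-cong {p} {q} (x ∷ xs) h rewrite h x (here refl) with q x
  ... | true  = cong (x ∷_) (filter-cong xs (λ y m → h y (there m)))
  ... | false = filter-cong xs (λ y m → h y (there m))

  filter-none : (p : A → Bool) (xs : List A) → (∀ x → x ∈ xs → p x ≡ false) → filterᵇ p xs ≡ []
  filter-none p []       h = refl
  filter-none p (x ∷ xs) h rewrite h x (here refl) = filter-none p xs (λ y m → h y (there m))

  filter-++ : (p : A → Bool) (xs ys : List A) → filterᵇ p (xs ++ ys) ≡ filterᵇ p xs ++ filterᵇ p ys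
  filter-++ p []       ys = refl
  filter-++ p (x ∷ xs) ys with p x
  ... | true  = cong (x ∷_) (filter-++ p xs ys)
  ... | false = filter-++ p xs ys

  length-filter-partition : (p : A → Bool) (xs : List A) →
    length (filterᵇ p xs) + length (filterᵇ (not ∘ p) xs) ≡ length xs
  length-filter-partition p []       = refl
  length-filter-partition p (x ∷ xs) with p x
  ... | true  = cong suc (length-filter-partition p xs)
  ... | false = trans (NP.+-suc _ _) (cong suc (length-filter-partition p xs))

  length-filter-map : {B : Set} (p : B → Bool) (f : A → B) (xs : List A) →
    length (filterᵇ p (map f xs)) ≡ length (filterᵇ (p ∘ f) xs)
  length-filter-map p f []       = refl
  length-filter-map p f (x ∷ xs) with p (f x)
  ... | true  = cong suc (length-filter-map p f xs)
  ... | false = length-filter-map p f xs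

  length-filter-↭ : (p : A → Bool) {xs ys : List A} → xs ↭ ys → length (filterᵇ p xs) ≡ length (filterᵇ p ys)
  length-filter-↭ p Perm.refl = refl
  length-filter-↭ p (prep x q) with p x
  ... | true  = cong suc (length-filter-↭ p q)
  ... | false = length-filter-↭ p q
  length-filter-↭ p (swap x y q) with p x | p y
  ... | true  | true  = cong (suc ∘ suc) (length-filter-↭ p q)
  ... | true  | false = cong suc (length-filter-↭ p q)
  ... | false | true  = cong suc (length-filter-↭ p q)
  ... | false | false = length-filter-↭ p q
  length-filter-↭ p (Perm.trans q q′) = trans (length-filter-↭ p q) (length-filter-↭ p q′)

Σ : ∀ {A : Set} → List A → (A → ℚ) → ℚ
Σ xs f = sumℚ (map f xs)

guard : Bool → ℚ → ℚ
guard b v = if b then v else 0ℚ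

guard-∧ : ∀ a b v → guard (a ∧ b) v ≡ guard a (guard b v)
guard-∧ true  b v = refl
guard-∧ false b v = refl

guard-comm : ∀ a b v → guard a (guard b v) ≡ guard b (guard a v)
guard-comm true  true  v = refl
guard-comm true  false v = refl
guard-comm false true  v = refl
guard-comm false false v = refl

guard-rotate : ∀ a b c e v → guard a (guard b (guard c (guard e v))) ≡ guard e (guard a (guard b (guard c v)))
guard-rotate a b c e v = begin
  guard a (guard b (guard c (guard e v))) ≡⟨ cong (λ t → guard a (guard b t)) (guard-comm c e v) ⟩
  guard a (guard b (guard e (guard c v))) ≡⟨ cong (guard a) (guard-comm b e _) ⟩
  guard a (guard e (guard b (guard c v))) ≡⟨ guard-comm a e _ ⟩
  guard e (guard a (guard b (guard c v))) ∎

Σ-++ : ∀ {A : Set} (xs ys : List A) (f : A → ℚ) → Σ (xs ++ ys) f ≡ Σ xs f +ℚ Σ ys f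
Σ-++ []       ys f = sym (QP.+-identityˡ _)
Σ-++ (x ∷ xs) ys f = trans (cong (f x +ℚ_) (Σ-++ xs ys f)) (sym (QP.+-assoc (f x) _ _))

Σ-map : ∀ {A B : Set} (g : A → B) (xs : List A) (f : B → ℚ) → Σ (map g xs) f ≡ Σ xs (f ∘ g)
Σ-map g []       f = refl
Σ-map g (x ∷ xs) f = cong (f (g x) +ℚ_) (Σ-map g xs f)

Σ-cong : ∀ {A : Set} (xs : List A) {f g : A → ℚ} → (∀ x → x ∈ xs → f x ≡ g x) → Σ xs f ≡ Σ xs g
Σ-cong []       h = refl
Σ-cong (x ∷ xs) h = cong₂ _+ℚ_ (h x (here refl)) (Σ-cong xs (λ y m → h y (there m)))

Σ-cong′ : ∀ {A : Set} (xs : List A) {f g : A → ℚ} → (∀ x → f x ≡ g x) → Σ xs f ≡ Σ xs g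
Σ-cong′ xs h = Σ-cong xs (λ x _ → h x)

Σ-zero : ∀ {A : Set} (xs : List A) {f : A → ℚ} → (∀ x → x ∈ xs → f x ≡ 0ℚ) → Σ xs f ≡ 0ℚ
Σ-zero []       h = refl
Σ-zero (x ∷ xs) h = trans (cong₂ _+ℚ_ (h x (here refl)) (Σ-zero xs (λ y m → h y (there m))))
                          (QP.+-identityˡ 0ℚ)

Σ-+ : ∀ {A : Set} (xs : List A) (f g : A → ℚ) → Σ xs (λ x → f x +ℚ g x) ≡ Σ xs f +ℚ Σ xs g
Σ-+ []       f g = refl
Σ-+ (x ∷ xs) f g = begin
  (f x +ℚ g x) +ℚ Σ xs (λ x → f x +ℚ g x) ≡⟨ cong ((f x +ℚ g x) +ℚ_) (Σ-+ xs f g) ⟩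
  (f x +ℚ g x) +ℚ (Σ xs f +ℚ Σ xs g)      ≡⟨ QP.+-assoc (f x) (g x) _ ⟩
  f x +ℚ (g x +ℚ (Σ xs f +ℚ Σ xs g))      ≡⟨ cong (f x +ℚ_) (sym (QP.+-assoc (g x) _ _)) ⟩
  f x +ℚ ((g x +ℚ Σ xs f) +ℚ Σ xs g)      ≡⟨ cong (λ t → f x +ℚ (t +ℚ Σ xs g)) (QP.+-comm (g x) _) ⟩
  f x +ℚ ((Σ xs f +ℚ g x) +ℚ Σ xs g)      ≡⟨ cong (f x +ℚ_) (QP.+-assoc (Σ xs f) _ _) ⟩
  f x +ℚ (Σ xs f +ℚ (g x +ℚ Σ xs g))      ≡⟨ sym (QP.+-assoc (f x) _ _) ⟩
  (f x +ℚ Σ xs f) +ℚ (g x +ℚ Σ xs g)      ∎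

Σ-swap : ∀ {A B : Set} (xs : List A) (ys : List B) (f : A → B → ℚ) →
  Σ xs (λ a → Σ ys (f a)) ≡ Σ ys (λ b → Σ xs (λ a → f a b))
Σ-swap []       ys f = sym (Σ-zero ys (λ _ _ → refl))
Σ-swap (x ∷ xs) ys f = trans (cong (Σ ys (f x) +ℚ_) (Σ-swap xs ys f))
                             (sym (Σ-+ ys (f x) (λ b → Σ xs (λ a → f a b))))

Σ-filter : ∀ {A : Set} (p : A → Bool) (xs : List A) (f : A → ℚ) → Σ (filterᵇ p xs) f ≡ Σ xs (λ x → guard (p x) (f x))
Σ-filter p []       f = refl
Σ-filter p (x ∷ xs) f with p x
... | true  = cong (f x +ℚ_) (Σ-filter p xs f)
... | false = trans (Σ-filter p xs f) (sym (QP.+-identityˡ _))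

Σ-guard : ∀ {A : Set} (b : Bool) (xs : List A) (f : A → ℚ) → guard b (Σ xs f) ≡ Σ xs (λ x → guard b (f x))
Σ-guard true  xs f = refl
Σ-guard false xs f = sym (Σ-zero xs (λ _ _ → refl))

Σ-concatMap : ∀ {A B : Set} (g : A → List B) (xs : List A) (f : B → ℚ) →
  Σ (concatMap g xs) f ≡ Σ xs (λ x → Σ (g x) f)
Σ-concatMap g []       f = refl
Σ-concatMap g (x ∷ xs) f = trans (Σ-++ (g x) (concatMap g xs) f) (cong (Σ (g x) f +ℚ_) (Σ-concatMap g xs f))

frac-suc : ∀ a c → Data.Rational.toℚᵘ (frac a (suc c)) U.≃ U.mkℚᵘ (+ a) c
frac-suc a c = QP.toℚᵘ-fromℚᵘ (U.mkℚᵘ (+ a) c)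

frac-+ : ∀ a b c → frac (a + b) c ≡ frac a c +ℚ frac b c
frac-+ a b zero    = refl
frac-+ a b (suc c) = QP.toℚᵘ-injective (UP.≃-trans (frac-suc (a + b) c)
  (UP.≃-trans same-denominator (UP.≃-sym (UP.≃-trans (QP.toℚᵘ-homo-+ (frac a (suc c)) (frac b (suc c)))
     (UP.+-cong (frac-suc a c) (frac-suc b c))))))
  where
  ring : ∀ (x y s : ℤ) → (x ℤ.+ y) ℤ.* (s ℤ.* s) ≡ (x ℤ.* s ℤ.+ y ℤ.* s) ℤ.* s
  ring = solve-∀
  same-denominator : U.mkℚᵘ (+ (a + b)) c U.≃ (U.mkℚᵘ (+ a) c U.+ U.mkℚᵘ (+ b) c)
  same-denominator = U.*≡* (begin
    + (a + b) ℤ.* + (suc c * suc c)         ≡⟨ cong₂ ℤ._*_ (ZP.pos-+ a b) (ZP.pos-* (suc c) (suc c)) ⟩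
    (+ a ℤ.+ + b) ℤ.* (+ suc c ℤ.* + suc c) ≡⟨ ring (+ a) (+ b) (+ suc c) ⟩
    (+ a ℤ.* + suc c ℤ.+ + b ℤ.* + suc c) ℤ.* + suc c ∎)

frac-0 : ∀ c → frac 0 c ≡ 0ℚ
frac-0 zero    = refl
frac-0 (suc c) = QP.toℚᵘ-injective (UP.≃-trans (frac-suc 0 c) (U.*≡* refl))

frac-filter : ∀ {A : Set} (p : A → Bool) (xs : List A) c →
  frac (length (filterᵇ p xs)) c ≡ Σ xs (λ x → guard (p x) (frac 1 c))
frac-filter p []       c = frac-0 c
frac-filter p (x ∷ xs) c with p x
... | true  = trans (frac-+ 1 (length (filterᵇ p xs)) c) (cong (frac 1 c +ℚ_) (frac-filter p xs c))
... | false = trans (frac-filter p xs c) (sym (QP.+-identityˡ _))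

*-rotate : ∀ a b c → (a *ℚ b) *ℚ c ≡ (c *ℚ a) *ℚ b
*-rotate a b c = begin
  (a *ℚ b) *ℚ c  ≡⟨ QP.*-assoc a b c ⟩
  a *ℚ (b *ℚ c)  ≡⟨ cong (a *ℚ_) (QP.*-comm b c) ⟩
  a *ℚ (c *ℚ b)  ≡⟨ sym (QP.*-assoc a c b) ⟩
  (a *ℚ c) *ℚ b  ≡⟨ cong (_*ℚ b) (QP.*-comm a c) ⟩
  (c *ℚ a) *ℚ b  ∎

Σ-const : ∀ {A : Set} (xs : List A) (c : ℚ) → Σ xs (λ _ → c) ≡ frac (length xs) 1 *ℚ c
Σ-const []       c = sym (QP.*-zeroˡ c)
Σ-const (x ∷ xs) c = begin
  c +ℚ Σ xs (λ _ → c)                         ≡⟨ cong₂ _+ℚ_ (sym (QP.*-identityˡ c)) (Σ-const xs c) ⟩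
  1ℚ *ℚ c +ℚ frac (length xs) 1 *ℚ c          ≡⟨ sym (QP.*-distribʳ-+ c 1ℚ (frac (length xs) 1)) ⟩
  (1ℚ +ℚ frac (length xs) 1) *ℚ c             ≡⟨ cong (_*ℚ c) (sym (frac-+ 1 (length xs) 1)) ⟩
  frac (suc (length xs)) 1 *ℚ c               ∎

eqSeq-sym : ∀ {n} (a b : List (Fin n)) → eqSeq a b ≡ eqSeq b a
eqSeq-sym []      []      = refl
eqSeq-sym []      (_ ∷ _) = refl
eqSeq-sym (_ ∷ _) []      = refl
eqSeq-sym (x ∷ a) (y ∷ b) = cong₂ _∧_ (does-sym Fin._≟_ x y) (eqSeq-sym a b)

eqSeq-refl : ∀ {n} (a : List (Fin n)) → eqSeq a a ≡ true
eqSeq-refl []      = refl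
eqSeq-refl (x ∷ a) rewrite dec-true (x Fin.≟ x) refl = eqSeq-refl a

eqSeq-sound : ∀ {n} (a b : List (Fin n)) → eqSeq a b ≡ true → a ≡ b
eqSeq-sound []      []      e = refl
eqSeq-sound (x ∷ a) (y ∷ b) e with x Fin.≟ y
... | yes refl = cong (x ∷_) (eqSeq-sound a b e)

allSeqs-length : ∀ n N → All (λ y → length y ≡ N) (allSeqs n N)
allSeqs-length n zero    = refl ∷ []
allSeqs-length n (suc N) =
  AllP.concat⁺ (AllP.map⁺ (All.universal (λ x → AllP.map⁺ (All.map (cong suc) (allSeqs-length n N))) (allFin n)))

Σ-allFin-select : ∀ {n} (v : Fin n) (h : Fin n → ℚ) → Σ (allFin n) (λ x → guard (does (v Fin.≟ x)) (h x)) ≡ h v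
Σ-allFin-select {suc n} v h = begin
    guard (does (v Fin.≟ Fin.zero)) (h Fin.zero) +ℚ Σ (tabulate Fin.suc) (λ x → guard (does (v Fin.≟ x)) (h x))
      ≡⟨ cong (λ t → guard (does (v Fin.≟ Fin.zero)) (h Fin.zero) +ℚ Σ t (λ x → guard (does (v Fin.≟ x)) (h x)))
              (sym (LP.map-tabulate id Fin.suc)) ⟩
    guard (does (v Fin.≟ Fin.zero)) (h Fin.zero) +ℚ Σ (map Fin.suc (allFin n)) (λ x → guard (does (v Fin.≟ x)) (h x))
      ≡⟨ cong (guard (does (v Fin.≟ Fin.zero)) (h Fin.zero) +ℚ_) (Σ-map Fin.suc (allFin n) _) ⟩
    guard (does (v Fin.≟ Fin.zero)) (h Fin.zero) +ℚ Σ (allFin n) (λ x → guard (does (v Fin.≟ Fin.suc x)) (h (Fin.suc x)))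
      ≡⟨ by-cases v ⟩
    h v ∎
  where
  by-cases : ∀ v → guard (does (v Fin.≟ Fin.zero)) (h Fin.zero)
                     +ℚ Σ (allFin n) (λ x → guard (does (v Fin.≟ Fin.suc x)) (h (Fin.suc x))) ≡ h v
  by-cases Fin.zero    = trans (cong (h Fin.zero +ℚ_) (Σ-zero (allFin n) (λ _ _ → refl))) (QP.+-identityʳ _)
  by-cases (Fin.suc v) = trans (QP.+-identityˡ _) (Σ-allFin-select v (h ∘ Fin.suc))

Σ-allSeqs-select : ∀ n N (y₀ : List (Fin n)) → length y₀ ≡ N → (h : List (Fin n) → ℚ) →
  Σ (allSeqs n N) (λ y → guard (eqSeq y₀ y) (h y)) ≡ h y₀
Σ-allSeqs-select n .0 [] refl h = QP.+-identityʳ _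
Σ-allSeqs-select n .(suc (length w)) (v ∷ w) refl h = begin
  Σ (concatMap (λ x → map (x ∷_) (allSeqs n (length w))) (allFin n)) (λ y → guard (eqSeq (v ∷ w) y) (h y))
    ≡⟨ Σ-concatMap _ (allFin n) _ ⟩
  Σ (allFin n) (λ x → Σ (map (x ∷_) (allSeqs n (length w))) (λ y → guard (eqSeq (v ∷ w) y) (h y)))
    ≡⟨ Σ-cong′ (allFin n) head-fixed ⟩
  Σ (allFin n) (λ x → guard (does (v Fin.≟ x)) (h (x ∷ w)))
    ≡⟨ Σ-allFin-select v (λ x → h (x ∷ w)) ⟩
  h (v ∷ w) ∎
  where
  head-fixed : ∀ x → Σ (map (x ∷_) (allSeqs n (length w))) (λ y → guard (eqSeq (v ∷ w) y) (h y))
                     ≡ guard (does (v Fin.≟ x)) (h (x ∷ w))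
  head-fixed x = begin
    Σ (map (x ∷_) (allSeqs n (length w))) (λ y → guard (eqSeq (v ∷ w) y) (h y))
      ≡⟨ Σ-map (x ∷_) (allSeqs n (length w)) _ ⟩
    Σ (allSeqs n (length w)) (λ ys → guard (does (v Fin.≟ x) ∧ eqSeq w ys) (h (x ∷ ys)))
      ≡⟨ Σ-cong′ (allSeqs n (length w)) (λ ys → guard-∧ (does (v Fin.≟ x)) (eqSeq w ys) (h (x ∷ ys))) ⟩
    Σ (allSeqs n (length w)) (λ ys → guard (does (v Fin.≟ x)) (guard (eqSeq w ys) (h (x ∷ ys))))
      ≡⟨ sym (Σ-guard (does (v Fin.≟ x)) (allSeqs n (length w)) _) ⟩
    guard (does (v Fin.≟ x)) (Σ (allSeqs n (length w)) (λ ys → guard (eqSeq w ys) (h (x ∷ ys))))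
      ≡⟨ cong (guard (does (v Fin.≟ x))) (Σ-allSeqs-select n (length w) w refl (λ ys → h (x ∷ ys))) ⟩
    guard (does (v Fin.≟ x)) (h (x ∷ w)) ∎

module _ {A : Set} where

  applyUpTo-+ : ∀ (f : ℕ → A) a b → applyUpTo f (a + b) ≡ applyUpTo f a ++ applyUpTo (λ i → f (a + i)) b
  applyUpTo-+ f zero    b = refl
  applyUpTo-+ f (suc a) b = cong (f 0 ∷_) (applyUpTo-+ (f ∘ suc) a b)

  take-+ : ∀ m n (xs : List A) → take (m + n) xs ≡ take m xs ++ take n (drop m xs)
  take-+ zero    n xs       = refl
  take-+ (suc m) n []       = sym (LP.take-[] n)
  take-+ (suc m) n (x ∷ xs) = cong (x ∷_) (take-+ m n xs)

  take-prefix : ∀ k (u v : List A) → length u ≡ k → take k (u ++ v) ≡ u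
  take-prefix .0 []      v refl = refl
  take-prefix .(suc (length u)) (x ∷ u) v refl = cong (x ∷_) (take-prefix (length u) u v refl)

  drop-prefix : ∀ k (u v : List A) → length u ≡ k → drop k (u ++ v) ≡ v
  drop-prefix .0 []      v refl = refl
  drop-prefix .(suc (length u)) (x ∷ u) v refl = drop-prefix (length u) u v refl

  length-split : ∀ k M (y : List A) → length y ≡ k * suc M →
    length (take k y) ≡ k × length (drop k y) ≡ k * M
  length-split k M y e =
    trans (LP.length-take k y) (trans (cong (k ℕ.⊓_) e′) (NP.m≤n⇒m⊓n≡m (NP.m≤m+n k (k * M)))) ,
    trans (LP.length-drop k y) (trans (cong (_∸ k) e′) (NP.m+n∸m≡n k (k * M)))
    where e′ : length y ≡ k + k * M
          e′ = trans e (NP.*-suc k M)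

module Blocks {n : ℕ} (k : ℕ) where

  edge-zero : ∀ (y : List (Fin n)) → edge k y 0 ≡ take k y
  edge-zero y rewrite NP.*-zeroʳ k = refl

  edge-suc : ∀ (y : List (Fin n)) i → edge k y (suc i) ≡ edge k (drop k y) i
  edge-suc y i = cong (take k) (trans (cong (λ t → drop t y) (NP.*-suc k i)) (sym (LP.drop-drop k (k * i) y)))

  edges-suc : ∀ M (y : List (Fin n)) → edges k (suc M) y ≡ edge k y 0 ∷ edges k M (drop k y)
  edges-suc M y = cong (edge k y 0 ∷_) (begin
    map (edge k y) (applyUpTo suc M)      ≡⟨ cong (map (edge k y)) (sym (LP.map-upTo suc M)) ⟩
    map (edge k y) (map suc (upTo M))     ≡⟨ sym (LP.map-∘ (upTo M)) ⟩
    map (edge k y ∘ suc) (upTo M)         ≡⟨ LP.map-cong (edge-suc y) (upTo M) ⟩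
    map (edge k (drop k y)) (upTo M)      ∎)

  setBlock-zero : ∀ (b y : List (Fin n)) → setBlock k 0 b y ≡ b ++ drop k y
  setBlock-zero b y rewrite NP.*-zeroʳ k = refl

  setBlock-suc : ∀ i (b y : List (Fin n)) → setBlock k (suc i) b y ≡ take k y ++ setBlock k i b (drop k y)
  setBlock-suc i b y = begin
    take (k * suc i) y ++ b ++ drop (k * suc i + k) y
      ≡⟨ cong₂ (λ s t → take s y ++ b ++ drop t y) (NP.*-suc k i)
               (trans (cong (_+ k) (NP.*-suc k i)) (NP.+-assoc k (k * i) k)) ⟩
    take (k + k * i) y ++ b ++ drop (k + (k * i + k)) y
      ≡⟨ cong₂ (λ s t → s ++ b ++ t) (take-+ k (k * i) y) (sym (LP.drop-drop k (k * i + k) y)) ⟩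
    (take k y ++ take (k * i) (drop k y)) ++ b ++ drop (k * i + k) (drop k y)
      ≡⟨ LP.++-assoc (take k y) _ _ ⟩
    take k y ++ setBlock k i b (drop k y) ∎

  edge-length : ∀ M (y : List (Fin n)) i → length y ≡ k * M → i < M → length (edge k y i) ≡ k
  edge-length (suc M) y zero    e _         = trans (cong length (edge-zero y)) (proj₁ (length-split k M y e))
  edge-length (suc M) y (suc i) e (s≤s i<M) =
    trans (cong length (edge-suc y i)) (edge-length M (drop k y) i (proj₂ (length-split k M y e)) i<M)

  setBlock-length : ∀ M (y : List (Fin n)) i b → length y ≡ k * M → i < M → length b ≡ k →
    length (setBlock k i b y) ≡ k * M
  setBlock-length (suc M) y zero b e _ eb = begin
    length (setBlock k 0 b y)          ≡⟨ cong length (setBlock-zero b y) ⟩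
    length (b ++ drop k y)             ≡⟨ LP.length-++ b ⟩
    length b + length (drop k y)       ≡⟨ cong₂ _+_ eb (proj₂ (length-split k M y e)) ⟩
    k + k * M                          ≡⟨ sym (NP.*-suc k M) ⟩
    k * suc M                          ∎
  setBlock-length (suc M) y (suc i) b e (s≤s i<M) eb = begin
    length (setBlock k (suc i) b y)                          ≡⟨ cong length (setBlock-suc i b y) ⟩
    length (take k y ++ setBlock k i b (drop k y))           ≡⟨ LP.length-++ (take k y) ⟩
    length (take k y) + length (setBlock k i b (drop k y))
      ≡⟨ cong₂ _+_ (proj₁ (length-split k M y e))
                   (setBlock-length M (drop k y) i b (proj₂ (length-split k M y e)) i<M eb) ⟩
    k + k * M                                                ≡⟨ sym (NP.*-suc k M) ⟩
    k * suc M                                                ∎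

  setBlock-edge : ∀ M (y : List (Fin n)) i b j → length y ≡ k * M → i < M → length b ≡ k →
    edge k (setBlock k i b y) j ≡ (if i ≡ᵇ j then b else edge k y j)
  setBlock-edge (suc M) y zero b zero e _ eb =
    trans (edge-zero _) (trans (cong (take k) (setBlock-zero b y)) (take-prefix k b _ eb))
  setBlock-edge (suc M) y zero b (suc j) e _ eb = begin
    edge k (setBlock k 0 b y) (suc j)          ≡⟨ edge-suc _ j ⟩
    edge k (drop k (setBlock k 0 b y)) j       ≡⟨ cong (λ t → edge k (drop k t) j) (setBlock-zero b y) ⟩
    edge k (drop k (b ++ drop k y)) j          ≡⟨ cong (λ t → edge k t j) (drop-prefix k b _ eb) ⟩
    edge k (drop k y) j                        ≡⟨ sym (edge-suc y j) ⟩
    edge k y (suc j)                           ∎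
  setBlock-edge (suc M) y (suc i) b zero e _ eb = begin
    edge k (setBlock k (suc i) b y) 0                  ≡⟨ edge-zero _ ⟩
    take k (setBlock k (suc i) b y)                    ≡⟨ cong (take k) (setBlock-suc i b y) ⟩
    take k (take k y ++ setBlock k i b (drop k y))     ≡⟨ take-prefix k (take k y) _ (proj₁ (length-split k M y e)) ⟩
    take k y                                           ≡⟨ sym (edge-zero y) ⟩
    edge k y 0                                         ∎
  setBlock-edge (suc M) y (suc i) b (suc j) e (s≤s i<M) eb = begin
    edge k (setBlock k (suc i) b y) (suc j)
      ≡⟨ edge-suc _ j ⟩
    edge k (drop k (setBlock k (suc i) b y)) j
      ≡⟨ cong (λ t → edge k (drop k t) j) (setBlock-suc i b y) ⟩
    edge k (drop k (take k y ++ setBlock k i b (drop k y))) j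
      ≡⟨ cong (λ t → edge k t j) (drop-prefix k (take k y) _ (proj₁ (length-split k M y e))) ⟩
    edge k (setBlock k i b (drop k y)) j
      ≡⟨ setBlock-edge M (drop k y) i b j (proj₂ (length-split k M y e)) i<M eb ⟩
    (if i ≡ᵇ j then b else edge k (drop k y) j)
      ≡⟨ cong (if i ≡ᵇ j then b else_) (sym (edge-suc y j)) ⟩
    (if i ≡ᵇ j then b else edge k y (suc j)) ∎

  edges-ext : ∀ M (y y′ : List (Fin n)) → length y ≡ k * M → length y′ ≡ k * M →
    (∀ j → j < M → edge k y j ≡ edge k y′ j) → y ≡ y′
  edges-ext zero y y′ e e′ h = trans (empty y (trans e (NP.*-zeroʳ k))) (sym (empty y′ (trans e′ (NP.*-zeroʳ k))))
    where empty : ∀ (u : List (Fin n)) → length u ≡ 0 → u ≡ []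
          empty [] _ = refl
  edges-ext (suc M) y y′ e e′ h = begin
    y                          ≡⟨ sym (LP.take++drop≡id k y) ⟩
    take k y ++ drop k y       ≡⟨ cong₂ _++_ first-block other-blocks ⟩
    take k y′ ++ drop k y′     ≡⟨ LP.take++drop≡id k y′ ⟩
    y′                         ∎
    where
    first-block : take k y ≡ take k y′
    first-block = trans (sym (edge-zero y)) (trans (h 0 (s≤s z≤n)) (edge-zero y′))
    other-blocks : drop k y ≡ drop k y′
    other-blocks = edges-ext M (drop k y) (drop k y′) (proj₂ (length-split k M y e)) (proj₂ (length-split k M y′ e′))
      (λ j j<M → trans (sym (edge-suc y j)) (trans (h (suc j) (s≤s j<M)) (edge-suc y′ j)))

transpose : ℕ → ℕ → ℕ → ℕ
transpose i j p = if j ≡ᵇ p then i else (if i ≡ᵇ p then j else p)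

transposeAll : List (ℕ × ℕ) → ℕ → ℕ
transposeAll []             p = p
transposeAll ((i , j) ∷ ps) p = transpose i j (transposeAll ps p)

transpose-fix : ∀ i j p → ¬ p ≡ i → ¬ p ≡ j → transpose i j p ≡ p
transpose-fix i j p p≢i p≢j rewrite ≡ᵇ-false j p (p≢j ∘ sym) | ≡ᵇ-false i p (p≢i ∘ sym) = refl

transpose-left : ∀ i j → ¬ i ≡ j → transpose i j i ≡ j
transpose-left i j i≢j rewrite ≡ᵇ-false j i (i≢j ∘ sym) | ≡ᵇ-refl i = refl

transpose-right : ∀ i j → transpose i j j ≡ i
transpose-right i j rewrite ≡ᵇ-refl j = refl

transpose-same : ∀ i p → transpose i i p ≡ p
transpose-same i p with i ≡ᵇ p in eq
... | true  = ≡ᵇ-sound i p eq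
... | false = refl

InRange : ℕ → List (ℕ × ℕ) → Set
InRange M ps = All (λ pr → proj₁ pr < M × proj₂ pr < M) ps

zip-InRange : ∀ {M} S T → All (_< M) S → All (_< M) T → InRange M (zip S T)
zip-InRange []      T       _          _          = []
zip-InRange (s ∷ S) []      _          _          = []
zip-InRange (s ∷ S) (t ∷ T) (s<M ∷ S<M) (t<M ∷ T<M) = (s<M , t<M) ∷ zip-InRange S T S<M T<M

module Swaps {n : ℕ} (k M : ℕ) where
  open Blocks {n} k

  swapAll : List (ℕ × ℕ) → List (Fin n) → List (Fin n)
  swapAll ps y = foldl (swapBlocks k) y ps

  swapBlocks-length : ∀ (y : List (Fin n)) i j → length y ≡ k * M → i < M → j < M →
    length (swapBlocks k y (i , j)) ≡ k * M
  swapBlocks-length y i j e i<M j<M =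
    setBlock-length M _ j _ (setBlock-length M y i _ e i<M (edge-length M y j e j<M)) j<M (edge-length M y i e i<M)

  swapBlocks-edge : ∀ (y : List (Fin n)) i j → length y ≡ k * M → i < M → j < M → ∀ p →
    edge k (swapBlocks k y (i , j)) p ≡ edge k y (transpose i j p)
  swapBlocks-edge y i j e i<M j<M p
    rewrite setBlock-edge M (setBlock k i (edge k y j) y) j (edge k y i) p
              (setBlock-length M y i _ e i<M (edge-length M y j e j<M)) j<M (edge-length M y i e i<M)
          | setBlock-edge M y i (edge k y j) p e i<M (edge-length M y j e j<M)
    with j ≡ᵇ p | i ≡ᵇ p
  ... | true  | _     = refl
  ... | false | true  = refl
  ... | false | false = refl

  swapAll-length : ∀ ps (y : List (Fin n)) → InRange M ps → length y ≡ k * M → length (swapAll ps y) ≡ k * M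
  swapAll-length []             y []                e = e
  swapAll-length ((i , j) ∷ ps) y ((i<M , j<M) ∷ r) e =
    swapAll-length ps (swapBlocks k y (i , j)) r (swapBlocks-length y i j e i<M j<M)

  swapAll-edge : ∀ ps (y : List (Fin n)) → InRange M ps → length y ≡ k * M → ∀ p →
    edge k (swapAll ps y) p ≡ edge k y (transposeAll ps p)
  swapAll-edge []             y []                e p = refl
  swapAll-edge ((i , j) ∷ ps) y ((i<M , j<M) ∷ r) e p =
    trans (swapAll-edge ps (swapBlocks k y (i , j)) r (swapBlocks-length y i j e i<M j<M) p)
          (swapBlocks-edge y i j e i<M j<M (transposeAll ps p))

Exchangeable : ℕ → List ℕ → List ℕ → Set
Exchangeable R S T = Unique S × Unique T × All (_< R) S × All (R ≤_) T × length S ≡ length T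

∉-All : ∀ {x : ℕ} {xs} → All (λ y → ¬ x ≡ y) xs → x ∉ xs
∉-All ps m = All.lookup ps m refl

module Exchange (R : ℕ) where

  below≢above : ∀ {s t} → s < R → R ≤ t → ¬ s ≡ t
  below≢above s<R R≤t refl = NP.<⇒≱ s<R R≤t

  below∉ : ∀ {s T} → s < R → All (R ≤_) T → s ∉ T
  below∉ s<R R≤T m = NP.<⇒≱ s<R (All.lookup R≤T m)

  above∉ : ∀ {t S} → R ≤ t → All (_< R) S → t ∉ S
  above∉ R≤t S<R m = NP.<⇒≱ (All.lookup S<R m) R≤t

  exchangeable-tail : ∀ {s t S T} → Exchangeable R (s ∷ S) (t ∷ T) → Exchangeable R S T
  exchangeable-tail (_ AP.∷ uS , _ AP.∷ uT , _ ∷ S<R , _ ∷ R≤T , e) = uS , uT , S<R , R≤T , NP.suc-injective e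

  exchange-fix : ∀ S T → Exchangeable R S T → ∀ p → p ∉ S → p ∉ T → transposeAll (zip S T) p ≡ p
  exchange-fix []      []      _ p _ _ = refl
  exchange-fix (s ∷ S) (t ∷ T) c p p∉S p∉T =
    trans (cong (transpose s t) (exchange-fix S T (exchangeable-tail c) p (p∉S ∘ there) (p∉T ∘ there)))
          (transpose-fix s t p (p∉S ∘ here) (p∉T ∘ here))

  exchange-maps : ∀ S T → Exchangeable R S T → ∀ p →
    (p ∈ S → transposeAll (zip S T) p ∈ T) × (p ∈ T → transposeAll (zip S T) p ∈ S)
  exchange-maps []      []      _ p = (λ ()) , (λ ())
  exchange-maps (s ∷ S) (t ∷ T) c@(uS AP.∷ _ , uT AP.∷ _ , s<R ∷ S<R , R≤t ∷ R≤T , _) p = from-S , from-T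
    where
    c′ : Exchangeable R S T
    c′ = exchangeable-tail c
    from-S : p ∈ s ∷ S → transposeAll (zip (s ∷ S) (t ∷ T)) p ∈ t ∷ T
    from-S (here refl) rewrite exchange-fix S T c′ s (∉-All uS) (below∉ s<R R≤T) =
      here (transpose-left s t (below≢above s<R R≤t))
    from-S (there m) with transposeAll (zip S T) p | proj₁ (exchange-maps S T c′ p) m
    ... | q | q∈T = there (subst (_∈ T) (sym (transpose-fix s t q
                      (λ q≡s → below≢above s<R (All.lookup R≤T q∈T) (sym q≡s))
                      (λ q≡t → ∉-All uT (subst (_∈ T) q≡t q∈T)))) q∈T)
    from-T : p ∈ t ∷ T → transposeAll (zip (s ∷ S) (t ∷ T)) p ∈ s ∷ S
    from-T (here refl) rewrite exchange-fix S T c′ t (above∉ R≤t S<R) (∉-All uT) = here (transpose-right s t)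
    from-T (there m) with transposeAll (zip S T) p | proj₂ (exchange-maps S T c′ p) m
    ... | q | q∈S = there (subst (_∈ S) (sym (transpose-fix s t q
                      (λ q≡s → ∉-All uS (subst (_∈ S) q≡s q∈S))
                      (λ q≡t → below≢above (All.lookup S<R q∈S) R≤t q≡t))) q∈S)

  exchange-involutive : ∀ S T → Exchangeable R S T → ∀ p → transposeAll (zip S T) (transposeAll (zip S T) p) ≡ p
  exchange-involutive []      []      _ p = refl
  exchange-involutive (s ∷ S) (t ∷ T) c@(uS AP.∷ _ , uT AP.∷ _ , s<R ∷ S<R , R≤t ∷ R≤T , _) p
    with p NP.≟ s | p NP.≟ t
  ... | yes refl | _
    rewrite exchange-fix S T (exchangeable-tail c) p (∉-All uS) (below∉ s<R R≤T)
          | transpose-left p t (below≢above s<R R≤t)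
          | exchange-fix S T (exchangeable-tail c) t (above∉ R≤t S<R) (∉-All uT) = transpose-right p t
  ... | no _ | yes refl
    rewrite exchange-fix S T (exchangeable-tail c) p (above∉ R≤t S<R) (∉-All uT)
          | transpose-right s p
          | exchange-fix S T (exchangeable-tail c) s (∉-All uS) (below∉ s<R R≤T) = transpose-left s p (below≢above s<R R≤t)
  ... | no p≢s | no p≢t = begin
      transpose s t (σ (transpose s t (σ p))) ≡⟨ cong (λ u → transpose s t (σ u)) (transpose-fix s t (σ p) σp≢s σp≢t) ⟩
      transpose s t (σ (σ p))                 ≡⟨ cong (transpose s t) (exchange-involutive S T c′ p) ⟩
      transpose s t p                         ≡⟨ transpose-fix s t p p≢s p≢t ⟩
      p                                       ∎
    where
    c′ : Exchangeable R S T
    c′ = exchangeable-tail c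
    σ : ℕ → ℕ
    σ = transposeAll (zip S T)
    σp≢s : ¬ σ p ≡ s
    σp≢s eq = p≢s (trans (sym (exchange-involutive S T c′ p))
                         (trans (cong σ eq) (exchange-fix S T c′ s (∉-All uS) (below∉ s<R R≤T))))
    σp≢t : ¬ σ p ≡ t
    σp≢t eq = p≢t (trans (sym (exchange-involutive S T c′ p))
                         (trans (cong σ eq) (exchange-fix S T c′ t (above∉ R≤t S<R) (∉-All uT))))

relabel-one-↭ : ∀ (σ : ℕ → ℕ) a c (ys : List ℕ) → Unique ys → a ∈ ys → σ a ≡ c →
  (∀ y → y ∈ ys → ¬ y ≡ a → σ y ≡ y) → (a ∷ map σ ys) ↭ (c ∷ ys)
relabel-one-↭ σ a c (y ∷ ys) (u AP.∷ us) (here refl) σa≡c fixed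
  rewrite σa≡c
        | LP.map-id-local {f = σ} {xs = ys}
            (All.tabulate (λ {z} m → fixed z (there m) (λ z≡a → ∉-All u (subst (_∈ ys) z≡a m)))) = swap a c ↭-refl
relabel-one-↭ σ a c (y ∷ ys) (u AP.∷ us) (there m) σa≡c fixed with y NP.≟ a
... | yes refl = ⊥-elim (∉-All u m)
... | no y≢a rewrite fixed y (here refl) y≢a =
  ↭-trans (swap a y ↭-refl)
          (↭-trans (prep y (relabel-one-↭ σ a c ys us m σa≡c (λ z m′ → fixed z (there m′)))) (swap y c ↭-refl))

∈-tail : ∀ {A : Set} {x z : A} {xs} → z ∈ x ∷ xs → ¬ x ≡ z → z ∈ xs
∈-tail (here z≡x) x≢z = ⊥-elim (x≢z (sym z≡x))
∈-tail (there m)  _   = m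

map-transpose-↭ : ∀ i j (xs : List ℕ) → Unique xs → i ∈ xs → j ∈ xs → map (transpose i j) xs ↭ xs
map-transpose-↭ i j xs u i∈ j∈ with i NP.≟ j
... | yes refl rewrite LP.map-cong (transpose-same i) xs | LP.map-id xs = ↭-refl
map-transpose-↭ i j (x ∷ xs) (u AP.∷ us) i∈ j∈ | no i≢j with x NP.≟ i | x NP.≟ j
... | yes refl | _ rewrite transpose-left x j i≢j =
  relabel-one-↭ (transpose x j) j x xs us (∈-tail j∈ i≢j) (transpose-right x j)
    (λ y y∈ y≢j → transpose-fix x j y (λ y≡x → ∉-All u (subst (_∈ xs) y≡x y∈)) y≢j)
... | no _ | yes refl rewrite transpose-right i x =
  relabel-one-↭ (transpose i x) i x xs us (∈-tail i∈ (i≢j ∘ sym)) (transpose-left i x i≢j)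
    (λ y y∈ y≢i → transpose-fix i x y y≢i (λ y≡x → ∉-All u (subst (_∈ xs) y≡x y∈)))
... | no x≢i | no x≢j rewrite transpose-fix i j x x≢i x≢j =
  prep x (map-transpose-↭ i j xs us (∈-tail i∈ x≢i) (∈-tail j∈ x≢j))

map-transposeAll-↭ : ∀ ps (xs : List ℕ) → Unique xs → All (λ pr → proj₁ pr ∈ xs × proj₂ pr ∈ xs) ps →
  map (transposeAll ps) xs ↭ xs
map-transposeAll-↭ []             xs u []                 rewrite LP.map-id xs = ↭-refl
map-transposeAll-↭ ((i , j) ∷ ps) xs u ((i∈ , j∈) ∷ r) rewrite LP.map-∘ {g = transpose i j} {f = transposeAll ps} xs =
  ↭-trans (PermP.map⁺ (transpose i j) (map-transposeAll-↭ ps xs u r)) (map-transpose-↭ i j xs u i∈ j∈)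

-- Membership in ℰ depends only on the multiset of edges

module Invariance (n : ℕ) where

  sameMultiset-sym : ∀ e e′ → sameMultiset n e e′ ≡ sameMultiset n e′ e
  sameMultiset-sym e e′ = all-cong (allFin n) (λ v → does-sym NP._≟_ (count v e) (count v e′))

  noMultiple-↭ : {xs ys : List (List (Fin n))} → xs ↭ ys → noMultiple n xs ≡ noMultiple n ys
  noMultiple-↭ Perm.refl  = refl
  noMultiple-↭ (prep x q) = cong₂ _∧_ (all-↭ _ q) (noMultiple-↭ q)
  noMultiple-↭ {x ∷ y ∷ xs} {_ ∷ _ ∷ ys} (swap _ _ q) = begin
    (not (x ≈ y) ∧ distinct x xs) ∧ (distinct y xs ∧ noMultiple n xs)
      ≡⟨ ∧-interchange (not (x ≈ y)) _ _ _ ⟩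
    (not (x ≈ y) ∧ distinct y xs) ∧ (distinct x xs ∧ noMultiple n xs)
      ≡⟨ cong₂ (λ a b → (not a ∧ b) ∧ (distinct x xs ∧ noMultiple n xs))
               (sameMultiset-sym x y) (all-↭ (λ e′ → not (y ≈ e′)) q) ⟩
    (not (y ≈ x) ∧ distinct y ys) ∧ (distinct x xs ∧ noMultiple n xs)
      ≡⟨ cong₂ (λ a b → (not (y ≈ x) ∧ distinct y ys) ∧ (a ∧ b)) (all-↭ (λ e′ → not (x ≈ e′)) q) (noMultiple-↭ q) ⟩
    (not (y ≈ x) ∧ distinct y ys) ∧ (distinct x ys ∧ noMultiple n ys) ∎
    where
    _≈_ : List (Fin n) → List (Fin n) → Bool
    _≈_ = sameMultiset n
    distinct : List (Fin n) → List (List (Fin n)) → Bool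
    distinct e es = all (λ e′ → not (e ≈ e′)) es
  noMultiple-↭ (Perm.trans q q′) = trans (noMultiple-↭ q) (noMultiple-↭ q′)

  count-++ : ∀ (v : Fin n) a b → count v (a ++ b) ≡ count v a + count v b
  count-++ v []      b = refl
  count-++ v (x ∷ a) b with does (v Fin.≟ x)
  ... | true  = cong suc (count-++ v a b)
  ... | false = count-++ v a b

  count-edges : ∀ k M (y : List (Fin n)) (v : Fin n) → length y ≡ k * M →
    count v y ≡ sum (map (count v) (edges k M y))
  count-edges k zero    []      v e = refl
  count-edges k zero    (x ∷ y) v e = ⊥-elim (NP.1+n≢0 (trans e (NP.*-zeroʳ k)))
  count-edges k (suc M) y       v e = begin
    count v y                                              ≡⟨ cong (count v) (sym (LP.take++drop≡id k y)) ⟩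
    count v (take k y ++ drop k y)                         ≡⟨ count-++ v (take k y) (drop k y) ⟩
    count v (take k y) + count v (drop k y)
      ≡⟨ cong₂ _+_ (cong (count v) (sym (edge-zero y)))
                   (count-edges k M (drop k y) v (proj₂ (length-split k M y e))) ⟩
    count v (edge k y 0) + sum (map (count v) (edges k M (drop k y)))
      ≡⟨ cong (λ t → sum (map (count v) t)) (sym (edges-suc M y)) ⟩
    sum (map (count v) (edges k (suc M) y))                ∎
    where open Blocks {n} k

  inE-↭ : ∀ d k M (y y′ : List (Fin n)) → length y ≡ k * M → length y′ ≡ k * M →
    edges k M y ↭ edges k M y′ → inE n d k M y ≡ inE n d k M y′
  inE-↭ d k M y y′ e e′ p =
    cong₂ _∧_ same-inS (cong₂ _∧_ (noMultiple-↭ p) (cong₂ _∧_ (cong (≤L n d) (length-filter-↭ (isLoop n) p)) (all-↭ _ p)))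
    where
    same-inS : inS n d y ≡ inS n d y′
    same-inS = cong₂ _∧_ (cong (_≡ᵇ n * d) (trans e (sym e′)))
      (all-cong (allFin n) (λ v → cong (_≡ᵇ d) (begin
        count v y                                ≡⟨ count-edges k M y v e ⟩
        sum (map (count v) (edges k M y))        ≡⟨ sum-↭ (PermP.map⁺ (count v) p) ⟩
        sum (map (count v) (edges k M y′))       ≡⟨ sym (count-edges k M y′ v e′) ⟩
        count v y′                               ∎)))

sublists : List ℕ → List (List ℕ)
sublists []       = [] ∷ []
sublists (x ∷ xs) = map (x ∷_) (sublists xs) ++ sublists xs

eqL : List ℕ → List ℕ → Bool
eqL a b = does (LP.≡-dec NP._≟_ a b)

memb : ℕ → List ℕ → Bool
memb i S = does (i ∈? S)

∈-map-cons⁻ : ∀ {A : Set} {x : A} {S} (Ls : List (List A)) → S ∈ map (x ∷_) Ls → ∃ λ S′ → S ≡ x ∷ S′ × S′ ∈ Ls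
∈-map-cons⁻ Ls m with MP.∈-map⁻ (_ ∷_) m
... | S′ , m′ , e = S′ , e , m′

sublists-⊆ : ∀ xs {S} → S ∈ sublists xs → S ⊆ xs
sublists-⊆ []       (here refl) = ⊆[]
sublists-⊆ (x ∷ xs) m with MP.∈-++⁻ (map (x ∷_) (sublists xs)) m
... | inj₁ m′ with ∈-map-cons⁻ (sublists xs) m′
...   | S′ , refl , m″ = refl ∷⊆ sublists-⊆ xs m″
sublists-⊆ (x ∷ xs) m | inj₂ m′ = x ∷ʳ sublists-⊆ xs m′

choose-⊆ : ∀ q (xs : List ℕ) {T} → T ∈ choose q xs → T ⊆ xs × length T ≡ q
choose-⊆ zero    []       (here refl) = ⊆[] , refl
choose-⊆ zero    (x ∷ xs) (here refl) = x ∷ʳ proj₁ (choose-⊆ zero xs (here refl)) , refl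
choose-⊆ (suc q) (x ∷ xs) m with MP.∈-++⁻ (map (x ∷_) (choose q xs)) m
... | inj₁ m′ with ∈-map-cons⁻ (choose q xs) m′
...   | S′ , refl , m″ = refl ∷⊆ proj₁ (choose-⊆ q xs m″) , cong suc (proj₂ (choose-⊆ q xs m″))
choose-⊆ (suc q) (x ∷ xs) m | inj₂ m′ = x ∷ʳ proj₁ (choose-⊆ (suc q) xs m′) , proj₂ (choose-⊆ (suc q) xs m′)

Unique-resp-⊆ : ∀ {S xs : List ℕ} → S ⊆ xs → Unique xs → Unique S
Unique-resp-⊆ ⊆[]           _            = AP.[]
Unique-resp-⊆ (refl ∷⊆ s)  (a AP.∷ u)  = All-resp-⊆ s a AP.∷ Unique-resp-⊆ s u
Unique-resp-⊆ (_ ∷ʳ s)     (_ AP.∷ u)  = Unique-resp-⊆ s u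

memb-true : ∀ {i S} → i ∈ S → memb i S ≡ true
memb-true {i} {S} = dec-true (i ∈? S)

memb-false : ∀ {i S} → i ∉ S → memb i S ≡ false
memb-false {i} {S} = dec-false (i ∈? S)

memb-cons : ∀ {i x S} → ¬ i ≡ x → memb i (x ∷ S) ≡ memb i S
memb-cons {i} {x} i≢x rewrite ≡ᵇ-false i x i≢x = refl

filter-memb : ∀ {S xs} → S ⊆ xs → Unique xs → filterᵇ (λ i → memb i S) xs ≡ S
filter-memb ⊆[] u = refl
filter-memb {x ∷ S} {x ∷ xs} (refl ∷⊆ s) (a AP.∷ u) rewrite memb-true {x} {x ∷ S} (here refl) =
  cong (x ∷_) (trans (filter-cong xs (λ y m → memb-cons {y} {x} {S} (λ y≡x → ∉-All a (subst (_∈ xs) y≡x m))))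
                     (filter-memb s u))
filter-memb {S} {x ∷ xs} (x ∷ʳ s) (a AP.∷ u) rewrite memb-false {x} {S} (λ m → ∉-All a (lookup s m)) =
  filter-memb s u

length-filter-memb-∨ : ∀ {T xs} (q : ℕ → Bool) → T ⊆ xs → Unique xs → All (λ t → q t ≡ false) T →
  length (filterᵇ (λ i → memb i T ∨ q i) xs) ≡ length T + length (filterᵇ q xs)
length-filter-memb-∨ q ⊆[] u a = refl
length-filter-memb-∨ {x ∷ T} {x ∷ xs} q (refl ∷⊆ s) (b AP.∷ u) (qx ∷ a)
  rewrite memb-true {x} {x ∷ T} (here refl) | qx =
  cong suc (trans (cong length (filter-cong xs (λ y m → cong (_∨ q y)
                     (memb-cons {y} {x} {T} (λ y≡x → ∉-All b (subst (_∈ xs) y≡x m))))))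
                  (length-filter-memb-∨ q s u a))
length-filter-memb-∨ {T} {x ∷ xs} q (x ∷ʳ s) (b AP.∷ u) a
  rewrite memb-false {x} {T} (λ m → ∉-All b (lookup s m)) with q x
... | true  = trans (cong suc (length-filter-memb-∨ q s u a)) (sym (NP.+-suc (length T) _))
... | false = length-filter-memb-∨ q s u a

eqL-refl : ∀ a → eqL a a ≡ true
eqL-refl a = dec-true (LP.≡-dec NP._≟_ a a) refl

eqL-false : ∀ a b → ¬ a ≡ b → eqL a b ≡ false
eqL-false a b = dec-false (LP.≡-dec NP._≟_ a b)

eqL-cons : ∀ x a b → eqL (x ∷ a) (x ∷ b) ≡ eqL a b
eqL-cons x a b rewrite ≡ᵇ-refl x = refl

Σ-sublists-select : ∀ (xs : List ℕ) → Unique xs → (p : ℕ → Bool) → (g : List ℕ → ℚ) →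
  Σ (sublists xs) (λ S → guard (eqL S (filterᵇ p xs)) (g S)) ≡ g (filterᵇ p xs)
Σ-sublists-select []       u p g = QP.+-identityʳ _
Σ-sublists-select (x ∷ xs) (a AP.∷ u) p g with p x
... | true = begin
  Σ (map (x ∷_) (sublists xs) ++ sublists xs) (λ S → guard (eqL S (x ∷ F)) (g S))
    ≡⟨ Σ-++ (map (x ∷_) (sublists xs)) (sublists xs) _ ⟩
  Σ (map (x ∷_) (sublists xs)) (λ S → guard (eqL S (x ∷ F)) (g S)) +ℚ Σ (sublists xs) (λ S → guard (eqL S (x ∷ F)) (g S))
    ≡⟨ cong₂ _+ℚ_ with-x without-x ⟩
  g (x ∷ F) +ℚ 0ℚ
    ≡⟨ QP.+-identityʳ _ ⟩
  g (x ∷ F) ∎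
  where
  F : List ℕ
  F = filterᵇ p xs
  with-x : Σ (map (x ∷_) (sublists xs)) (λ S → guard (eqL S (x ∷ F)) (g S)) ≡ g (x ∷ F)
  with-x = trans (Σ-map (x ∷_) (sublists xs) _)
    (trans (Σ-cong′ (sublists xs) (λ S → cong (λ b → guard b (g (x ∷ S))) (eqL-cons x S F)))
           (Σ-sublists-select xs u p (g ∘ (x ∷_))))
  without-x : Σ (sublists xs) (λ S → guard (eqL S (x ∷ F)) (g S)) ≡ 0ℚ
  without-x = Σ-zero (sublists xs) (λ S m → cong (λ b → guard b (g S)) (eqL-false _ _
    (λ S≡ → ∉-All a (lookup (sublists-⊆ xs m) (subst (x ∈_) (sym S≡) (here refl))))))
... | false = begin
  Σ (map (x ∷_) (sublists xs) ++ sublists xs) (λ S → guard (eqL S F) (g S))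
    ≡⟨ Σ-++ (map (x ∷_) (sublists xs)) (sublists xs) _ ⟩
  Σ (map (x ∷_) (sublists xs)) (λ S → guard (eqL S F) (g S)) +ℚ Σ (sublists xs) (λ S → guard (eqL S F) (g S))
    ≡⟨ cong₂ _+ℚ_ with-x (Σ-sublists-select xs u p g) ⟩
  0ℚ +ℚ g F
    ≡⟨ QP.+-identityˡ _ ⟩
  g F ∎
  where
  F : List ℕ
  F = filterᵇ p xs
  with-x : Σ (map (x ∷_) (sublists xs)) (λ S → guard (eqL S F) (g S)) ≡ 0ℚ
  with-x = trans (Σ-map (x ∷_) (sublists xs) _)
    (Σ-zero (sublists xs) (λ S m → cong (λ b → guard b (g (x ∷ S))) (eqL-false _ _
      (λ x∷S≡F → ∉-All a (filter-⊆ p xs (subst (x ∈_) x∷S≡F (here refl)))))))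

length-choose : ∀ {A : Set} q (xs : List A) → length (choose q xs) ≡ length xs C q
length-choose zero    xs       = refl
length-choose (suc q) []       = refl
length-choose (suc q) (x ∷ xs) = begin
  length (map (x ∷_) (choose q xs) ++ choose (suc q) xs)      ≡⟨ LP.length-++ (map (x ∷_) (choose q xs)) ⟩
  length (map (x ∷_) (choose q xs)) + length (choose (suc q) xs)
    ≡⟨ cong₂ _+_ (trans (LP.length-map (x ∷_) (choose q xs)) (length-choose q xs)) (length-choose (suc q) xs) ⟩
  length xs C q + length xs C suc q                            ≡⟨ nCk+nC[k+1]≡[n+1]C[k+1] (length xs) q ⟩
  suc (length xs) C suc q                                      ∎

choose-filter : ∀ {A : Set} (p : A → Bool) q (xs : List A) → choose q (filterᵇ p xs) ≡ filterᵇ (all p) (choose q xs)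
choose-filter p zero    xs       = refl
choose-filter p (suc q) []       = refl
choose-filter p (suc q) (x ∷ xs) with p x in px
... | true = begin
  map (x ∷_) (choose q (filterᵇ p xs)) ++ choose (suc q) (filterᵇ p xs)
    ≡⟨ cong₂ _++_ (cong (map (x ∷_)) (choose-filter p q xs)) (choose-filter p (suc q) xs) ⟩
  map (x ∷_) (filterᵇ (all p) (choose q xs)) ++ filterᵇ (all p) (choose (suc q) xs)
    ≡⟨ cong (_++ filterᵇ (all p) (choose (suc q) xs)) (map-cons-filter (choose q xs)) ⟩
  filterᵇ (all p) (map (x ∷_) (choose q xs)) ++ filterᵇ (all p) (choose (suc q) xs)
    ≡⟨ sym (filter-++ (all p) (map (x ∷_) (choose q xs)) (choose (suc q) xs)) ⟩
  filterᵇ (all p) (map (x ∷_) (choose q xs) ++ choose (suc q) xs) ∎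
  where
  map-cons-filter : ∀ Ls → map (x ∷_) (filterᵇ (all p) Ls) ≡ filterᵇ (all p) (map (x ∷_) Ls)
  map-cons-filter [] = refl
  map-cons-filter (c ∷ Ls) rewrite px with all p c
  ... | true  = cong ((x ∷ c) ∷_) (map-cons-filter Ls)
  ... | false = map-cons-filter Ls
... | false = begin
  choose (suc q) (filterᵇ p xs)
    ≡⟨ choose-filter p (suc q) xs ⟩
  filterᵇ (all p) (choose (suc q) xs)
    ≡⟨ cong (_++ filterᵇ (all p) (choose (suc q) xs)) (sym (filter-map-cons (choose q xs))) ⟩
  filterᵇ (all p) (map (x ∷_) (choose q xs)) ++ filterᵇ (all p) (choose (suc q) xs)
    ≡⟨ sym (filter-++ (all p) (map (x ∷_) (choose q xs)) (choose (suc q) xs)) ⟩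
  filterᵇ (all p) (map (x ∷_) (choose q xs) ++ choose (suc q) xs) ∎
  where
  filter-map-cons : ∀ Ls → filterᵇ (all p) (map (x ∷_) Ls) ≡ []
  filter-map-cons []       = refl
  filter-map-cons (c ∷ Ls) rewrite px = filter-map-cons Ls

module Swapping (n d k M : ℕ) (nd≡kM : n * d ≡ k * M) where
  open Blocks {n} k
  open Swaps {n} k M
  open Invariance n

  -- Positions 0,…,R−1 are red, the G positions R,…,M−1 are green.
  R G : ℕ
  R = numRed k M
  G = M ∸ R

  R≤M : R ≤ M
  R≤M = NP.≤-trans (NP.*-mono-≤ r≤s (NP.≤-refl {m})) (subst (_≤ M) (NP.*-comm m s) (DM.m/n*n≤m M s))
    where s m : ℕ
          s = suc (2 * r k)
          m = mm k M
          r≤s : r k ≤ s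
          r≤s = NP.m≤n⇒m≤1+n (NP.m≤m+n (r k) (r k + 0))

  R+G≡M : R + G ≡ M
  R+G≡M = NP.m+[n∸m]≡n R≤M

  green : List ℕ
  green = map (λ j → R + j) (upTo G)

  upTo-split : upTo M ≡ upTo R ++ green
  upTo-split = begin
    upTo M                          ≡⟨ cong upTo (sym R+G≡M) ⟩
    upTo (R + G)                    ≡⟨ applyUpTo-+ id R G ⟩
    upTo R ++ applyUpTo (λ j → R + j) G    ≡⟨ cong (upTo R ++_) (sym (LP.map-upTo (λ j → R + j) G)) ⟩
    upTo R ++ green                 ∎

  unique-red : Unique (upTo R)
  unique-red = UqP.upTo⁺ R

  unique-green : Unique green
  unique-green = UqP.map⁺ (NP.+-cancelˡ-≡ R _ _) (UqP.upTo⁺ G)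

  red-range : All (_< R) (upTo R)
  red-range = AllP.all-upTo R

  green-range : All (λ t → R ≤ t × t < M) green
  green-range = AllP.map⁺ (All.tabulate (λ {j} j∈ →
    NP.m≤m+n R j , subst (R + j <_) R+G≡M (NP.+-monoʳ-< R (MP.∈-upTo⁻ j∈))))

  N : ℕ
  N = n * d

  Seqs : List (List (Fin n))
  Seqs = allSeqs n N

  seq-length : ∀ {y} → y ∈ Seqs → length y ≡ k * M
  seq-length m = trans (All.lookup (allSeqs-length n N) m) nd≡kM

  loopAt properAt : List (Fin n) → ℕ → Bool
  loopAt   y i = isLoop n (edge k y i)
  properAt y i = not (isLoop n (edge k y i))

  greenLoops : List (Fin n) → List ℕ
  greenLoops y = filterᵇ (loopAt y) green

  module Exchanging (S T : List ℕ) (S∈ : S ∈ sublists (upTo R)) (T∈ : T ∈ choose (length S) green) where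
    open Exchange R

    S⊆red : S ⊆ upTo R
    S⊆red = sublists-⊆ (upTo R) S∈

    T⊆green : T ⊆ green
    T⊆green = proj₁ (choose-⊆ (length S) green T∈)

    S-range : All (_< R) S
    S-range = All-resp-⊆ S⊆red red-range

    T-range : All (λ t → R ≤ t × t < M) T
    T-range = All-resp-⊆ T⊆green green-range

    |T|≡|S| : length T ≡ length S
    |T|≡|S| = proj₂ (choose-⊆ (length S) green T∈)

    exchangeable : Exchangeable R S T
    exchangeable = Unique-resp-⊆ S⊆red unique-red , Unique-resp-⊆ T⊆green unique-green , S-range ,
                   All.map proj₁ T-range , sym |T|≡|S|

    pairs : List (ℕ × ℕ)
    pairs = zip S T

    σ : ℕ → ℕ
    σ = transposeAll pairs

    pairs-in-range : InRange M pairs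
    pairs-in-range = zip-InRange S T (All.map (λ s<R → NP.<-≤-trans s<R R≤M) S-range) (All.map proj₂ T-range)

    σ-S : ∀ {i} → i ∈ S → σ i ∈ T
    σ-S = proj₁ (exchange-maps S T exchangeable _)

    σ-T : ∀ {i} → i ∈ T → σ i ∈ S
    σ-T = proj₂ (exchange-maps S T exchangeable _)

    σ-fix-red : ∀ {i} → i < R → i ∉ S → σ i ≡ i
    σ-fix-red i<R i∉S = exchange-fix S T exchangeable _ i∉S (λ i∈T → NP.<⇒≱ i<R (proj₁ (All.lookup T-range i∈T)))

    σ-fix-green : ∀ {i} → R ≤ i → i ∉ T → σ i ≡ i
    σ-fix-green R≤i i∉T = exchange-fix S T exchangeable _ (λ i∈S → NP.<⇒≱ (All.lookup S-range i∈S) R≤i) i∉T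

    swapAll-involutive : ∀ y → length y ≡ k * M → swapAll pairs (swapAll pairs y) ≡ y
    swapAll-involutive y e = edges-ext M _ y (swapAll-length pairs _ pairs-in-range e′) e (λ j _ → begin
      edge k (swapAll pairs (swapAll pairs y)) j ≡⟨ swapAll-edge pairs _ pairs-in-range e′ j ⟩
      edge k (swapAll pairs y) (σ j)             ≡⟨ swapAll-edge pairs y pairs-in-range e (σ j) ⟩
      edge k y (σ (σ j))                         ≡⟨ cong (edge k y) (exchange-involutive S T exchangeable j) ⟩
      edge k y j                                 ∎)
      where e′ : length (swapAll pairs y) ≡ k * M
            e′ = swapAll-length pairs y pairs-in-range e

    eqSeq-swapAll : ∀ z y → length z ≡ k * M → length y ≡ k * M →
      eqSeq z (swapAll pairs y) ≡ eqSeq (swapAll pairs z) y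
    eqSeq-swapAll z y ez ey = bool-ext _ _
      (λ e → subst (λ t → eqSeq t y ≡ true)
        (sym (trans (cong (swapAll pairs) (eqSeq-sound _ _ e)) (swapAll-involutive y ey))) (eqSeq-refl y))
      (λ e → subst (λ t → eqSeq z t ≡ true)
        (sym (trans (cong (swapAll pairs) (sym (eqSeq-sound _ _ e))) (swapAll-involutive z ez))) (eqSeq-refl z))

    edges-swapAll-↭ : ∀ y → length y ≡ k * M → edges k M (swapAll pairs y) ↭ edges k M y
    edges-swapAll-↭ y e = subst (_↭ edges k M y) (sym reindexed)
      (PermP.map⁺ (edge k y) (map-transposeAll-↭ pairs (upTo M) (UqP.upTo⁺ M)
        (All.map (λ (i<M , j<M) → MP.∈-upTo⁺ i<M , MP.∈-upTo⁺ j<M) pairs-in-range)))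
      where
      reindexed : edges k M (swapAll pairs y) ≡ map (edge k y) (map σ (upTo M))
      reindexed = trans (LP.map-cong (swapAll-edge pairs y pairs-in-range e) (upTo M)) (LP.map-∘ (upTo M))

  -- Fraction of the equally likely choices for y that produce z, and the
  -- unnormalised weight W(z) = Σ_{y ∈ ℰ} hitFraction z y, so P(Y' = z) = W(z)/|ℰ|.
  hitFraction : List (Fin n) → List (Fin n) → ℚ
  hitFraction z y = frac (length (filterᵇ (eqSeq z) (outcomes n k M y))) (length (outcomes n k M y))

  weight : List (Fin n) → ℚ
  weight z = Σ (listE n d k M) (hitFraction z)

  -- The answer: W(z) for z ∈ 𝒢_l equals  weightFormula l (G ∸ l).
  weightFormula : ℕ → ℕ → ℚ
  weightFormula a b =
    Σ (sublists (upTo R)) (λ S → frac (a C length S) 1 *ℚ frac 1 ((length S + b) C length S))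

  module Target (z : List (Fin n)) (l : ℕ) (z∈G : inG n d k M l z ≡ true) where

    z∈E : inE n d k M z ≡ true
    z∈E = proj₁ (∧-true z∈G)

    z-loops : (numLoops n k M z ≡ᵇ l) ≡ true
    z-loops = proj₁ (∧-true (proj₂ (∧-true {inE n d k M z} z∈G)))

    z-red-proper : all (λ e → not (isLoop n e)) (take R (edges k M z)) ≡ true
    z-red-proper = proj₂ (∧-true {numLoops n k M z ≡ᵇ l} (proj₂ (∧-true {inE n d k M z} z∈G)))

    z-length : length z ≡ k * M
    z-length = trans (≡ᵇ-sound _ _ (proj₁ (∧-true (proj₁ (∧-true z∈E))))) nd≡kM

    red-edges : take R (edges k M z) ≡ map (edge k z) (upTo R)
    red-edges = begin
      take R (map (edge k z) (upTo M))                         ≡⟨ cong (λ t → take R (map (edge k z) t)) upTo-split ⟩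
      take R (map (edge k z) (upTo R ++ green))                ≡⟨ cong (take R) (LP.map-++ (edge k z) (upTo R) green) ⟩
      take R (map (edge k z) (upTo R) ++ map (edge k z) green)
        ≡⟨ take-prefix R _ _ (trans (LP.length-map (edge k z) (upTo R)) (LP.length-upTo R)) ⟩
      map (edge k z) (upTo R)                                  ∎

    no-red-loop : ∀ i → i < R → loopAt z i ≡ false
    no-red-loop i i<R = not-true (all-true (λ e → not (isLoop n e)) (map (edge k z) (upTo R))
      (subst (λ t → all (λ e → not (isLoop n e)) t ≡ true) red-edges z-red-proper) (MP.∈-map⁺ (edge k z) (MP.∈-upTo⁺ i<R)))

    -- The only sequence y that the exchange (S, T) turns into z is y₀ = σ_{S,T} z.
    module Preimage (S T : List ℕ) (S∈ : S ∈ sublists (upTo R)) (T∈ : T ∈ choose (length S) green) where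
      open Exchanging S T S∈ T∈ public

      y₀ : List (Fin n)
      y₀ = swapAll pairs z

      y₀-length : length y₀ ≡ k * M
      y₀-length = swapAll-length pairs z pairs-in-range z-length

      y₀-edge : ∀ p → edge k y₀ p ≡ edge k z (σ p)
      y₀-edge = swapAll-edge pairs z pairs-in-range z-length

      y₀∈E : inE n d k M y₀ ≡ true
      y₀∈E = trans (inE-↭ d k M y₀ z y₀-length z-length (edges-swapAll-↭ z z-length)) z∈E

      -- At the positions T, y₀ carries the (proper) red edges of z.
      T-proper : ∀ {i} → i ∈ T → loopAt y₀ i ≡ false
      T-proper {i} i∈T = trans (cong (isLoop n) (y₀-edge i)) (no-red-loop (σ i) (All.lookup S-range (σ-T i∈T)))

      all-T-proper : all (properAt y₀) T ≡ true
      all-T-proper = all-intro (properAt y₀) T (λ t t∈T → cong not (T-proper t∈T))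

      redLoops-y₀ : eqL S (redLoopIdx n k M y₀) ≡ all (loopAt z) T
      redLoops-y₀ with all (loopAt z) T in T-loops
      ... | true = trans (cong (eqL S) red-loops≡S) (eqL-refl S)
        where
        loop⇔S : ∀ i → i ∈ upTo R → loopAt y₀ i ≡ memb i S
        loop⇔S i i∈ with i ∈? S
        ... | yes i∈S = trans (cong (isLoop n) (y₀-edge i)) (all-true (loopAt z) T T-loops (σ-S i∈S))
        ... | no  i∉S = trans (cong (isLoop n) (trans (y₀-edge i) (cong (edge k z) (σ-fix-red (MP.∈-upTo⁻ i∈) i∉S))))
                              (no-red-loop i (MP.∈-upTo⁻ i∈))
        red-loops≡S : redLoopIdx n k M y₀ ≡ S
        red-loops≡S = trans (filter-cong (upTo R) loop⇔S) (filter-memb S⊆red unique-red)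
      ... | false with all-false (loopAt z) T T-loops
      ...   | t , t∈T , no-loop = eqL-false S _ (λ S≡ → false≢true (begin
        false                  ≡⟨ sym no-loop ⟩
        loopAt z t             ≡⟨ cong (isLoop n ∘ edge k z) (sym (exchange-involutive S T exchangeable t)) ⟩
        loopAt z (σ (σ t))     ≡⟨ cong (isLoop n) (sym (y₀-edge (σ t))) ⟩
        loopAt y₀ (σ t)        ≡⟨ filter-sound (loopAt y₀) (upTo R) (subst (σ t ∈_) S≡ (σ-T t∈T)) ⟩
        true                   ∎))
        where open Exchange R

      greenProper-y₀ : all (loopAt z) T ≡ true →
        length (greenProperIdx n k M y₀) ≡ length S + length (greenProperIdx n k M z)
      greenProper-y₀ T-loops = begin
        length (filterᵇ (properAt y₀) green)                          ≡⟨ cong length (filter-cong green proper⇔) ⟩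
        length (filterᵇ (λ i → memb i T ∨ properAt z i) green)
          ≡⟨ length-filter-memb-∨ (properAt z) T⊆green unique-green
               (All.tabulate (λ t∈T → cong not (all-true (loopAt z) T T-loops t∈T))) ⟩
        length T + length (filterᵇ (properAt z) green)
          ≡⟨ cong (_+ length (filterᵇ (properAt z) green)) |T|≡|S| ⟩
        length S + length (filterᵇ (properAt z) green)                ∎
        where
        proper⇔ : ∀ i → i ∈ green → properAt y₀ i ≡ memb i T ∨ properAt z i
        proper⇔ i i∈ with i ∈? T
        ... | yes i∈T = cong not (T-proper i∈T)
        ... | no  i∉T = cong (not ∘ isLoop n)
                          (trans (y₀-edge i) (cong (edge k z) (σ-fix-green (proj₁ (All.lookup green-range i∈)) i∉T)))

    numChoices : List (Fin n) → List ℕ → ℕ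
    numChoices y S = length (choose (length S) (greenProperIdx n k M y))

    -- The hits of y computed as if its red loops were at S: the choices are the
    -- |S|-subsets T of green positions, admissible when y is proper on T.
    hits : List (Fin n) → List ℕ → ℚ
    hits y S = Σ (choose (length S) green) (λ T →
      guard (all (properAt y) T) (guard (eqSeq z (swapAll (zip S T) y)) (frac 1 (numChoices y S))))

    -- The outcomes of y are indexed by the choices among its proper green positions,
    -- i.e. by the |S|-subsets of green on which y is proper.
    hitFraction-as-hits : ∀ y → hitFraction z y ≡ hits y (redLoopIdx n k M y)
    hitFraction-as-hits y = begin
      frac (length (filterᵇ (eqSeq z) (map outcome choices))) (length (map outcome choices))
        ≡⟨ cong (frac (length (filterᵇ (eqSeq z) (map outcome choices)))) (LP.length-map outcome choices) ⟩
      frac (length (filterᵇ (eqSeq z) (map outcome choices))) (length choices)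
        ≡⟨ frac-filter (eqSeq z) (map outcome choices) (length choices) ⟩
      Σ (map outcome choices) (λ w → guard (eqSeq z w) (frac 1 (length choices)))
        ≡⟨ Σ-map outcome choices _ ⟩
      Σ choices (λ c → guard (eqSeq z (outcome c)) (frac 1 (length choices)))
        ≡⟨ cong (λ Cs → Σ Cs (λ c → guard (eqSeq z (outcome c)) (frac 1 (length choices)))) (choose-filter (properAt y) q green) ⟩
      Σ (filterᵇ (all (properAt y)) (choose q green)) (λ c → guard (eqSeq z (outcome c)) (frac 1 (length choices)))
        ≡⟨ Σ-filter (all (properAt y)) (choose q green) _ ⟩
      hits y (redLoopIdx n k M y) ∎
      where
      q : ℕ
      q = length (redLoopIdx n k M y)
      choices : List (List ℕ)
      choices = choose q (greenProperIdx n k M y)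
      outcome : List ℕ → List (Fin n)
      outcome c = swapAll (zip (redLoopIdx n k M y) c) y

    choiceWeight : List (Fin n) → List ℕ → List ℕ → ℚ
    choiceWeight y S T = guard (eqL S (redLoopIdx n k M y)) (guard (inE n d k M y)
                           (guard (all (properAt y) T) (frac 1 (numChoices y S))))

    hitsAt : List (Fin n) → List ℕ → ℚ
    hitsAt y S = guard (eqL S (redLoopIdx n k M y)) (guard (inE n d k M y) (hits y S))

    hitsAt-by-choice : ∀ y S →
      hitsAt y S ≡ Σ (choose (length S) green) (λ T → guard (eqSeq z (swapAll (zip S T) y)) (choiceWeight y S T))
    hitsAt-by-choice y S = begin
      guard a (guard b (hits y S))       ≡⟨ cong (guard a) (Σ-guard b (choose (length S) green) _) ⟩
      guard a (Σ (choose (length S) green) _) ≡⟨ Σ-guard a (choose (length S) green) _ ⟩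
      Σ (choose (length S) green) _
        ≡⟨ Σ-cong′ (choose (length S) green) (λ T →
             guard-rotate a b (all (properAt y) T) (eqSeq z (swapAll (zip S T) y)) (frac 1 (numChoices y S))) ⟩
      Σ (choose (length S) green) (λ T → guard (eqSeq z (swapAll (zip S T) y)) (choiceWeight y S T)) ∎
      where a b : Bool
            a = eqL S (redLoopIdx n k M y)
            b = inE n d k M y

    gz : ℕ
    gz = length (greenProperIdx n k M z)

    choiceWeight-preimage : ∀ S T (S∈ : S ∈ sublists (upTo R)) (T∈ : T ∈ choose (length S) green) →
      choiceWeight (Preimage.y₀ S T S∈ T∈) S T ≡ guard (all (loopAt z) T) (frac 1 ((length S + gz) C length S))
    choiceWeight-preimage S T S∈ T∈
      rewrite Preimage.redLoops-y₀ S T S∈ T∈ | Preimage.y₀∈E S T S∈ T∈ | Preimage.all-T-proper S T S∈ T∈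
      with all (loopAt z) T in T-loops
    ... | true  = cong (frac 1) (trans (length-choose (length S) _)
                                       (cong (_C length S) (Preimage.greenProper-y₀ S T S∈ T∈ T-loops)))
    ... | false = refl

    subset-contribution : ∀ S → S ∈ sublists (upTo R) →
      Σ Seqs (λ y → hitsAt y S) ≡ frac (length (greenLoops z) C length S) 1 *ℚ frac 1 ((length S + gz) C length S)
    subset-contribution S S∈ = begin
      Σ Seqs (λ y → hitsAt y S)
        ≡⟨ Σ-cong′ Seqs (λ y → hitsAt-by-choice y S) ⟩
      Σ Seqs (λ y → Σ (choose (length S) green) (λ T → guard (eqSeq z (swapAll (zip S T) y)) (choiceWeight y S T)))
        ≡⟨ Σ-swap Seqs (choose (length S) green) _ ⟩
      Σ (choose (length S) green) (λ T → Σ Seqs (λ y → guard (eqSeq z (swapAll (zip S T) y)) (choiceWeight y S T)))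
        ≡⟨ Σ-cong (choose (length S) green) unique-preimage ⟩
      Σ (choose (length S) green) (λ T → guard (all (loopAt z) T) c)
        ≡⟨ sym (Σ-filter (all (loopAt z)) (choose (length S) green) (λ _ → c)) ⟩
      Σ (filterᵇ (all (loopAt z)) (choose (length S) green)) (λ _ → c)
        ≡⟨ cong (λ Ts → Σ Ts (λ _ → c)) (sym (choose-filter (loopAt z) (length S) green)) ⟩
      Σ (choose (length S) (greenLoops z)) (λ _ → c)
        ≡⟨ Σ-const (choose (length S) (greenLoops z)) c ⟩
      frac (length (choose (length S) (greenLoops z))) 1 *ℚ c
        ≡⟨ cong (λ t → frac t 1 *ℚ c) (length-choose (length S) (greenLoops z)) ⟩
      frac (length (greenLoops z) C length S) 1 *ℚ c ∎
      where
      c : ℚ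
      c = frac 1 ((length S + gz) C length S)
      unique-preimage : ∀ T → T ∈ choose (length S) green →
        Σ Seqs (λ y → guard (eqSeq z (swapAll (zip S T) y)) (choiceWeight y S T)) ≡ guard (all (loopAt z) T) c
      unique-preimage T T∈ = begin
        Σ Seqs (λ y → guard (eqSeq z (swapAll (zip S T) y)) (choiceWeight y S T))
          ≡⟨ Σ-cong Seqs (λ y y∈ → cong (λ b → guard b (choiceWeight y S T))
                                        (eqSeq-swapAll z y z-length (seq-length y∈))) ⟩
        Σ Seqs (λ y → guard (eqSeq y₀ y) (choiceWeight y S T))
          ≡⟨ Σ-allSeqs-select n N y₀ (trans y₀-length (sym nd≡kM)) (λ y → choiceWeight y S T) ⟩
        choiceWeight y₀ S T
          ≡⟨ choiceWeight-preimage S T S∈ T∈ ⟩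
        guard (all (loopAt z) T) c ∎
        where open Preimage S T S∈ T∈

    weight-by-subsets : weight z ≡ weightFormula (length (greenLoops z)) gz
    weight-by-subsets = begin
      Σ (filterᵇ (inE n d k M) Seqs) (hitFraction z)
        ≡⟨ Σ-filter (inE n d k M) Seqs (hitFraction z) ⟩
      Σ Seqs (λ y → guard (inE n d k M y) (hitFraction z y))
        ≡⟨ Σ-cong′ Seqs (λ y → trans (cong (guard (inE n d k M y)) (hitFraction-as-hits y))
             (sym (Σ-sublists-select (upTo R) unique-red (loopAt y) (λ S → guard (inE n d k M y) (hits y S))))) ⟩
      Σ Seqs (λ y → Σ (sublists (upTo R)) (hitsAt y))
        ≡⟨ Σ-swap Seqs (sublists (upTo R)) hitsAt ⟩
      Σ (sublists (upTo R)) (λ S → Σ Seqs (λ y → hitsAt y S))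
        ≡⟨ Σ-cong (sublists (upTo R)) subset-contribution ⟩
      weightFormula (length (greenLoops z)) gz ∎

    -- z has no red loops, so all of its l loops are green.
    greenLoops-length : length (greenLoops z) ≡ l
    greenLoops-length = begin
      length (greenLoops z)
        ≡⟨ cong (λ t → length (t ++ greenLoops z))
                (sym (filter-none (loopAt z) (upTo R) (λ i i∈ → no-red-loop i (MP.∈-upTo⁻ i∈)))) ⟩
      length (filterᵇ (loopAt z) (upTo R) ++ greenLoops z)  ≡⟨ cong length (sym (filter-++ (loopAt z) (upTo R) green)) ⟩
      length (filterᵇ (loopAt z) (upTo R ++ green))         ≡⟨ cong (λ t → length (filterᵇ (loopAt z) t)) (sym upTo-split) ⟩
      length (filterᵇ (loopAt z) (upTo M))                  ≡⟨ sym (length-filter-map (isLoop n) (edge k z) (upTo M)) ⟩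
      numLoops n k M z                                      ≡⟨ ≡ᵇ-sound _ _ z-loops ⟩
      l                                                     ∎

    greenProper-length : gz ≡ G ∸ l
    greenProper-length = begin
      gz                                      ≡⟨ sym (NP.m+n∸m≡n l gz) ⟩
      l + gz ∸ l                              ≡⟨ cong (λ t → t + gz ∸ l) (sym greenLoops-length) ⟩
      length (greenLoops z) + gz ∸ l          ≡⟨ cong (_∸ l) (length-filter-partition (loopAt z) green) ⟩
      length green ∸ l                        ≡⟨ cong (_∸ l) (trans (LP.length-map (λ j → R + j) (upTo G)) (LP.length-upTo G)) ⟩
      G ∸ l                                   ∎

    weight≡formula : weight z ≡ weightFormula l (G ∸ l)
    weight≡formula = trans weight-by-subsets (cong₂ weightFormula greenLoops-length greenProper-length)

  outcome-length : ∀ y → y ∈ listE n d k M → ∀ w → w ∈ outcomes n k M y → length w ≡ N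
  outcome-length y y∈ w w∈ with MP.∈-map⁻ (λ c → swapAll (zip (redLoopIdx n k M y) c) y) w∈
  ... | c , c∈ , refl =
    trans (swapAll-length _ y in-range (seq-length (filter-⊆ (inE n d k M) Seqs y∈))) (sym nd≡kM)
    where
    in-range : InRange M (zip (redLoopIdx n k M y) c)
    in-range = zip-InRange _ c
      (All.tabulate (λ m → NP.<-≤-trans (MP.∈-upTo⁻ (filter-⊆ (loopAt y) (upTo R) m)) R≤M))
      (All.tabulate (λ m → proj₂ (All.lookup green-range
        (filter-⊆ (properAt y) green (lookup (proj₁ (choose-⊆ (length (redLoopIdx n k M y)) (greenProperIdx n k M y) c∈)) m)))))

  guard-inG : ∀ l w → length w ≡ N → ∀ v → guard (inG n d k M l w) v ≡ Σ (listG n d k M l) (λ z → guard (eqSeq z w) v)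
  guard-inG l w w-length v = sym (begin
    Σ (filterᵇ (inG n d k M l) Seqs) (λ z → guard (eqSeq z w) v)
      ≡⟨ Σ-filter (inG n d k M l) Seqs _ ⟩
    Σ Seqs (λ z → guard (inG n d k M l z) (guard (eqSeq z w) v))
      ≡⟨ Σ-cong′ Seqs (λ z → trans (guard-comm (inG n d k M l z) (eqSeq z w) v)
                                  (cong (λ b → guard b (guard (inG n d k M l z) v)) (eqSeq-sym z w))) ⟩
    Σ Seqs (λ z → guard (eqSeq w z) (guard (inG n d k M l z) v))
      ≡⟨ Σ-allSeqs-select n N w w-length (λ z → guard (inG n d k M l z) v) ⟩
    guard (inG n d k M l w) v ∎)

  event-weight : ∀ l →
    Σ (listE n d k M) (λ y → frac (length (filterᵇ (inG n d k M l) (outcomes n k M y))) (length (outcomes n k M y)))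
      ≡ Σ (listG n d k M l) weight
  event-weight l = trans (Σ-cong (listE n d k M) split-outcomes) (Σ-swap (listE n d k M) (listG n d k M l) _)
    where
    split-outcomes : ∀ y → y ∈ listE n d k M →
      frac (length (filterᵇ (inG n d k M l) (outcomes n k M y))) (length (outcomes n k M y))
        ≡ Σ (listG n d k M l) (λ z → hitFraction z y)
    split-outcomes y y∈ = begin
      frac (length (filterᵇ (inG n d k M l) O)) c
        ≡⟨ frac-filter (inG n d k M l) O c ⟩
      Σ O (λ w → guard (inG n d k M l w) (frac 1 c))
        ≡⟨ Σ-cong O (λ w w∈ → guard-inG l w (outcome-length y y∈ w w∈) (frac 1 c)) ⟩
      Σ O (λ w → Σ (listG n d k M l) (λ z → guard (eqSeq z w) (frac 1 c)))
        ≡⟨ Σ-swap O (listG n d k M l) _ ⟩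
      Σ (listG n d k M l) (λ z → Σ O (λ w → guard (eqSeq z w) (frac 1 c)))
        ≡⟨ Σ-cong′ (listG n d k M l) (λ z → sym (frac-filter (eqSeq z) O c)) ⟩
      Σ (listG n d k M l) (λ z → hitFraction z y) ∎
      where O : List (List (Fin n))
            O = outcomes n k M y
            c : ℕ
            c = length (outcomes n k M y)

-- For z ∈ 𝒢_l:  P(Y' = z) · |𝒢_l| = W(z)/|ℰ| · |𝒢_l| = Σ_{z′ ∈ 𝒢_l} W(z′)/|ℰ| = P(Y' ∈ 𝒢_l),
-- because W is constant on 𝒢_l.
proposition8 : (k n d M l : ℕ) → 3 ≤ k → 1 ≤ n → 1 ≤ d → n * d ≡ k * M →
    ≤L n d l ≡ true →
    0ℚ <ℚ probY' n d k M (inG n d k M l) →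
    ∀ z → inG n d k M l z ≡ true →
    probY' n d k M (eqSeq z) *ℚ frac (length (listG n d k M l)) 1
      ≡ probY' n d k M (inG n d k M l)
proposition8 k n d M l _ _ _ nd≡kM _ _ z z∈G = begin
  (weight z *ℚ e) *ℚ g                     ≡⟨ cong (λ t → (t *ℚ e) *ℚ g) (Target.weight≡formula z l z∈G) ⟩
  (W *ℚ e) *ℚ g                            ≡⟨ *-rotate W e g ⟩
  (g *ℚ W) *ℚ e                            ≡⟨ cong (_*ℚ e) (sym (Σ-const (listG n d k M l) W)) ⟩
  Σ (listG n d k M l) (λ _ → W) *ℚ e       ≡⟨ cong (_*ℚ e) (sym (Σ-cong (listG n d k M l) weight-on-G)) ⟩
  Σ (listG n d k M l) weight *ℚ e          ≡⟨ cong (_*ℚ e) (sym (event-weight l)) ⟩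
  probY' n d k M (inG n d k M l)           ∎
  where
  open Swapping n d k M nd≡kM
  W e g : ℚ
  W = weightFormula l (G ∸ l)
  e = frac 1 (length (listE n d k M))
  g = frac (length (listG n d k M l)) 1
  weight-on-G : ∀ z′ → z′ ∈ listG n d k M l → weight z′ ≡ W
  weight-on-G z′ z′∈ = Target.weight≡formula z′ l (filter-sound (inG n d k M l) Seqs z′∈)
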